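{- Let $n$ be a positive integer with $n\equiv 9 \pmod{12}$. Then there exists a $3$-star system of order $n$ which is $(n-1)$-block-colourable.
   Context: A $3$-star is a copy of the complete bipartite graph $K_{1,3}$. A $3$-star system of order $n$ is a pair $(V,\mathcal{B})$ where $|V|=n$ and $\mathcal{B}$ is a set of $3$-stars (subgraphs of the complete graph $K_n$ on $V$) whose edge sets partition the edge set of $K_n$; the elements of $\mathcal B$ are called blocks. A block-colouring is a partition of $\mathcal{B}$ into colour classes such that the blocks in each colour class are pairwise vertex-disjoint. The system is $k$-block-colourable if it admits a block-colouring with $k$ colour classes. -}

module Defs where

open import Data.Nat using (ℕ; zero; suc; _+_; _∸_)
open import Data.Fin using (Fin; _≟_)
open import Data.Bool using (Bool; true; false; if_then_else_; _∧_; _∨_)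
open import Data.List using (List; _∷_; []; length; lookup)
open import Data.Product using (_×_; Σ; ∃; _,_)
open import Data.Sum using (_⊎_)
open import Relation.Nullary using (¬_)
open import Relation.Nullary.Decidable using (⌊_⌋)
open import Relation.Binary.PropositionalEquality using (_≡_; _≢_)
open import Function.Definitions using (Surjective)

-- A 3-star (copy of K_{1,3}) in K_n on vertex set Fin n:
-- a centre and three leaves, all four vertices pairwise distinct.
-- Its edges are {centre, leafᵢ} for i = 1,2,3.
record Star (n : ℕ) : Set where
  constructor star
  field
    centre : Fin n
    leaf₁  : Fin n
    leaf₂  : Fin n
    leaf₃  : Fin n
    c≢₁ : centre ≢ leaf₁
    c≢₂ : centre ≢ leaf₂
    c≢₃ : centre ≢ leaf₃
    1≢2 : leaf₁ ≢ leaf₂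
    1≢3 : leaf₁ ≢ leaf₃
    2≢3 : leaf₂ ≢ leaf₃
open Star public

_∈V_ : ∀ {n} → Fin n → Star n → Set
v ∈V s = v ≡ centre s ⊎ v ≡ leaf₁ s ⊎ v ≡ leaf₂ s ⊎ v ≡ leaf₃ s

sameEdge : ∀ {n} → Fin n → Fin n → Fin n → Fin n → Bool
sameEdge a b x y = (⌊ a ≟ x ⌋ ∧ ⌊ b ≟ y ⌋) ∨ (⌊ a ≟ y ⌋ ∧ ⌊ b ≟ x ⌋)

b2n : Bool → ℕ
b2n true  = 1
b2n false = 0

edgeMult : ∀ {n} → Star n → Fin n → Fin n → ℕ
edgeMult s x y = b2n (sameEdge (centre s) (leaf₁ s) x y)
               + b2n (sameEdge (centre s) (leaf₂ s) x y)
               + b2n (sameEdge (centre s) (leaf₃ s) x y)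

edgeCount : ∀ {n} → List (Star n) → Fin n → Fin n → ℕ
edgeCount []       x y = 0
edgeCount (s ∷ bs) x y = edgeMult s x y + edgeCount bs x y

IsStarSystem : (n : ℕ) → List (Star n) → Set
IsStarSystem n bs = ∀ (x y : Fin n) → x ≢ y → edgeCount bs x y ≡ 1

VertexDisjoint : ∀ {n} → Star n → Star n → Set
VertexDisjoint s t = ∀ v → ¬ (v ∈V s × v ∈V t)

-- a block-colouring with k colour classes: every block gets one of k
-- colours, each colour class is nonempty (a partition into k classes),
-- and distinct blocks of the same colour are vertex-disjoint.
IsBlockColouring : ∀ {n} (bs : List (Star n)) (k : ℕ) → (Fin (length bs) → Fin k) → Set
IsBlockColouring bs k col =
  Surjective _≡_ _≡_ col ×
  (∀ i j → i ≢ j → col i ≡ col j → VertexDisjoint (lookup bs i) (lookup bs j))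

BlockColourable : ∀ {n} (bs : List (Star n)) (k : ℕ) → Set
BlockColourable bs k = Σ (Fin (length bs) → Fin k) (IsBlockColouring bs k)

module Submission where

-- For n = 9 the system is explicit and checked by computation. For n = 3m with
-- m = 4q + 3 and q ≥ 1 the vertices are ℤₘ × {0, 1, 2} (cell, slot), and the blocks are all
-- translates, along the cells, of some base stars centred in cell 0: for every slot s and odd
-- difference δ ∈ {1, 3, …, m − 2} the fan from (0, s) to the whole cell δ (except s = 1,
-- δ = 1), and two special stars covering the edges inside a cell and the differences ±1.
-- As m is odd, exactly one of δ and m − δ is odd, so every edge is covered exactly once.
-- The 3m − 1 colour classes are translates as well: m for each of two classes of fans, whose
-- members are placed with centres in the cells 0, …, q and leaves in distinct cells among
-- q + 1, …, 4q + 1, and m − 1 classes of special stars.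

open import Algebra.Bundles using (AbelianGroup)
import Algebra.Properties.AbelianGroup
open import Algebra.Structures using (IsAbelianGroup)
open import Data.Empty using (⊥)
open import Data.Fin using (Fin; zero; suc; toℕ; _≟_; #_; fromℕ<; opposite; inject₁; lower₁; combine; remQuot)
open import Data.Fin.Patterns using (0F; 1F; 2F)
open import Data.Fin.Properties using (all?; any?; toℕ-fromℕ<; toℕ-injective; toℕ<n; opposite-involutive; toℕ-combine; combine-remQuot; remQuot-combine; combine-injective; combine-surjective; inject₁-lower₁; inject₁≡⇒lower₁≡; toℕ-inject₁; inject₁-injective)
open import Data.List using (List; []; _∷_; _++_; map; length; lookup; cartesianProduct; allFin; filter)
open import Data.List.Membership.Propositional using (_∈_)
open import Data.List.Membership.Propositional.Properties using (∈-allFin; ∈-filter⁺; ∈-filter⁻; ∈-cartesianProduct⁺; ∈-cartesianProduct⁻; ∈-map⁺; ∈-map⁻)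
open import Data.List.Relation.Unary.All as All using (All; _∷_)
import Data.List.Relation.Unary.All.Properties as AllP
open import Data.List.Relation.Unary.AllPairs using (_∷_)
open import Data.List.Relation.Unary.Any using (here; there)
open import Data.List.Relation.Unary.Unique.Propositional using (Unique)
import Data.List.Relation.Unary.Unique.Propositional.Properties as Unique
open import Data.Nat as ℕ using (ℕ; zero; suc; _+_; _*_; _∸_; _<_; _≤_; _≥_; s≤s; z≤n; s≤s⁻¹; NonZero)
open import Data.Nat.DivMod using (DivMod; _divMod_; _/_; _%_; _mod_; m≡m%n+[m/n]*n; m%n<n; m<n⇒m%n≡m; %-distribˡ-+; m%n%n≡m%n; n%n≡0; m*n%n≡0; [m+kn]%n≡m%n)
open import Data.Nat.Properties hiding (_≟_)
open import Data.Nat.Tactic.RingSolver using (solve-∀)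
open import Data.Product using (Σ; ∃; _×_; _,_; proj₁; proj₂; uncurry)
open import Data.Product.Properties using (≡-dec; ,-injective)
open import Data.Sum as Sum using (_⊎_; inj₁; inj₂)
open import Function using (_∘_)
open import Function.Consequences.Propositional using (strictlySurjective⇒surjective; surjective⇒strictlySurjective)
open import Function.Definitions using (Injective)
open import Level using (0ℓ)
open import Relation.Nullary using (Dec; yes; no; ¬_; contradiction)
open import Relation.Nullary.Decidable using (map′; toWitness; ¬?; _×-dec_; _⊎-dec_; _→-dec_)
open import Relation.Binary.PropositionalEquality using (_≡_; _≢_; ≢-sym; refl; sym; trans; cong; cong₂; subst; subst₂; isEquivalence; module ≡-Reasoning)

open import Defs

χ : {P : Set} → Dec P → ℕ
χ (yes _) = 1
χ (no _)  = 0

χ-yes : {P : Set} (p? : Dec P) → P → χ p? ≡ 1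
χ-yes (yes _) _ = refl
χ-yes (no ¬p) p = contradiction p ¬p

χ-no : {P : Set} (p? : Dec P) → ¬ P → χ p? ≡ 0
χ-no (yes p) ¬p = contradiction p ¬p
χ-no (no _)  _  = refl

χ-× : {P Q : Set} (p? : Dec P) (q? : Dec Q) → χ (p? ×-dec q?) ≡ χ p? * χ q?
χ-× (yes _) (yes _) = refl
χ-× (yes _) (no _)  = refl
χ-× (no _)  _       = refl

∑ : {A : Set} → List A → (A → ℕ) → ℕ
∑ []       f = 0
∑ (x ∷ xs) f = f x + ∑ xs f

syntax ∑ xs (λ x → e) = ∑[ x ∈ xs ] e

private
  variable
    A B : Set

∑-cong : ∀ (xs : List A) {f g : A → ℕ} → (∀ x → f x ≡ g x) → ∑ xs f ≡ ∑ xs g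
∑-cong []       f≗g = refl
∑-cong (x ∷ xs) f≗g = cong₂ _+_ (f≗g x) (∑-cong xs f≗g)

∑-+ : ∀ (xs : List A) (f g : A → ℕ) → ∑[ x ∈ xs ] (f x + g x) ≡ ∑ xs f + ∑ xs g
∑-+ []       f g = refl
∑-+ (x ∷ xs) f g rewrite ∑-+ xs f g = shuffle (f x) (g x) (∑ xs f) (∑ xs g)
  where
  shuffle : ∀ a b c d → a + b + (c + d) ≡ a + c + (b + d)
  shuffle = solve-∀

∑-++ : ∀ (xs ys : List A) (f : A → ℕ) → ∑ (xs ++ ys) f ≡ ∑ xs f + ∑ ys f
∑-++ []       ys f = refl
∑-++ (x ∷ xs) ys f rewrite ∑-++ xs ys f = sym (+-assoc (f x) (∑ xs f) (∑ ys f))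

∑-map : (g : A → B) (xs : List A) (f : B → ℕ) → ∑ (map g xs) f ≡ ∑[ x ∈ xs ] f (g x)
∑-map g []       f = refl
∑-map g (x ∷ xs) f = cong (f (g x) +_) (∑-map g xs f)

∑-cartesianProduct : (xs : List A) (ys : List B) (f : A × B → ℕ) →
  ∑ (cartesianProduct xs ys) f ≡ ∑[ x ∈ xs ] ∑[ y ∈ ys ] f (x , y)
∑-cartesianProduct []       ys f = refl
∑-cartesianProduct (x ∷ xs) ys f =
  trans (∑-++ (map (x ,_) ys) (cartesianProduct xs ys) f)
        (cong₂ _+_ (∑-map (x ,_) ys f) (∑-cartesianProduct xs ys f))

∑-vanish : ∀ (xs : List A) {f : A → ℕ} → (∀ {x} → x ∈ xs → f x ≡ 0) → ∑ xs f ≡ 0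
∑-vanish []       f≡0 = refl
∑-vanish (x ∷ xs) f≡0 rewrite f≡0 (here refl) = ∑-vanish xs (f≡0 ∘ there)

∑-single : ∀ {xs : List A} {f : A → ℕ} {a} → Unique xs → a ∈ xs →
  (∀ {x} → x ∈ xs → x ≢ a → f x ≡ 0) → ∑ xs f ≡ f a
∑-single {xs = x ∷ xs} {f} (x∉xs ∷ !xs) (here refl) others =
  trans (cong (f x +_) (∑-vanish xs (λ y∈xs → others (there y∈xs) (≢-sym (All.lookup x∉xs y∈xs)))))
        (+-identityʳ (f x))
∑-single {xs = x ∷ xs} {f} (x∉xs ∷ !xs) (there a∈xs) others
  rewrite others (here refl) (All.lookup x∉xs a∈xs) = ∑-single !xs a∈xs (others ∘ there)

∑-χ-unique : ∀ {P : A → Set} (P? : ∀ x → Dec (P x)) {xs : List A} {a} → Unique xs → a ∈ xs → P a →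
  (∀ {x} → x ∈ xs → P x → x ≡ a) → ∑[ x ∈ xs ] χ (P? x) ≡ 1
∑-χ-unique P? !xs a∈xs Pa onlyA =
  trans (∑-single !xs a∈xs (λ x∈xs x≢a → χ-no (P? _) (x≢a ∘ onlyA x∈xs))) (χ-yes (P? _) Pa)

∑-χ-none : ∀ {P : A → Set} (P? : ∀ x → Dec (P x)) (xs : List A) →
  (∀ {x} → x ∈ xs → ¬ P x) → ∑[ x ∈ xs ] χ (P? x) ≡ 0
∑-χ-none P? xs none = ∑-vanish xs (λ x∈xs → χ-no (P? _) (none x∈xs))

private
  variable
    n k : ℕ

leafCount : Star n → Fin n → ℕ
leafCount s y = χ (leaf₁ s ≟ y) + χ (leaf₂ s ≟ y) + χ (leaf₃ s ≟ y)

incidence : Star n → Fin n → Fin n → ℕ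
incidence s x y = χ (centre s ≟ x) * leafCount s y

sameEdge-incidence : ∀ (c l x y : Fin n) → x ≢ y →
  b2n (sameEdge c l x y) ≡ χ (c ≟ x) * χ (l ≟ y) + χ (c ≟ y) * χ (l ≟ x)
sameEdge-incidence c l x y x≢y with c ≟ x | c ≟ y
... | yes refl | yes refl = contradiction refl x≢y
... | yes _    | no _     with l ≟ y
...   | yes _ = refl
...   | no _  = refl
sameEdge-incidence c l x y x≢y | no _ | yes _ with l ≟ x
...   | yes _ = refl
...   | no _  = refl
sameEdge-incidence c l x y x≢y | no _ | no _ = refl

edgeMult-incidence : ∀ (s : Star n) x y → x ≢ y → edgeMult s x y ≡ incidence s x y + incidence s y x
edgeMult-incidence s x y x≢y =
  trans (cong₂ _+_ (cong₂ _+_ (split (leaf₁ s)) (split (leaf₂ s))) (split (leaf₃ s)))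
        (regroup (χ (centre s ≟ x)) (χ (centre s ≟ y))
                 (χ (leaf₁ s ≟ y)) (χ (leaf₂ s ≟ y)) (χ (leaf₃ s ≟ y))
                 (χ (leaf₁ s ≟ x)) (χ (leaf₂ s ≟ x)) (χ (leaf₃ s ≟ x)))
  where
  split = λ l → sameEdge-incidence (centre s) l x y x≢y
  regroup : ∀ a b p₁ p₂ p₃ q₁ q₂ q₃ →
    a * p₁ + b * q₁ + (a * p₂ + b * q₂) + (a * p₃ + b * q₃) ≡ a * (p₁ + p₂ + p₃) + b * (q₁ + q₂ + q₃)
  regroup = solve-∀

edgeCount-map : ∀ (f : A → Star n) xs x y → edgeCount (map f xs) x y ≡ ∑[ a ∈ xs ] edgeMult (f a) x y
edgeCount-map f []       x y = refl
edgeCount-map f (a ∷ xs) x y = cong (edgeMult (f a) x y +_) (edgeCount-map f xs x y)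

χ-injective : ∀ {f : Fin n → Fin k} → Injective _≡_ _≡_ f → ∀ a b → χ (f a ≟ f b) ≡ χ (a ≟ b)
χ-injective f-inj a b with a ≟ b
... | yes refl = χ-yes (_ ≟ _) refl
... | no a≢b   = χ-no (_ ≟ _) (a≢b ∘ f-inj)

mapStar : (f : Fin n → Fin k) → Injective _≡_ _≡_ f → Star n → Star k
mapStar f f-inj s = record
  { centre = f (centre s) ; leaf₁ = f (leaf₁ s) ; leaf₂ = f (leaf₂ s) ; leaf₃ = f (leaf₃ s)
  ; c≢₁ = c≢₁ s ∘ f-inj ; c≢₂ = c≢₂ s ∘ f-inj ; c≢₃ = c≢₃ s ∘ f-inj
  ; 1≢2 = 1≢2 s ∘ f-inj ; 1≢3 = 1≢3 s ∘ f-inj ; 2≢3 = 2≢3 s ∘ f-inj }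

module _ {f : Fin n → Fin k} (f-inj : Injective _≡_ _≡_ f) (s : Star n) where

  incidence-mapStar : ∀ x y → incidence (mapStar f f-inj s) (f x) (f y) ≡ incidence s x y
  incidence-mapStar x y rewrite χ-injective f-inj (centre s) x
    | χ-injective f-inj (leaf₁ s) y | χ-injective f-inj (leaf₂ s) y | χ-injective f-inj (leaf₃ s) y = refl

  mapStar-∈V⁻ : ∀ {v} → v ∈V mapStar f f-inj s → ∃ λ w → w ∈V s × v ≡ f w
  mapStar-∈V⁻ (inj₁ v≡c)                     = centre s , inj₁ refl , v≡c
  mapStar-∈V⁻ (inj₂ (inj₁ v≡l₁))             = leaf₁ s , inj₂ (inj₁ refl) , v≡l₁
  mapStar-∈V⁻ (inj₂ (inj₂ (inj₁ v≡l₂)))      = leaf₂ s , inj₂ (inj₂ (inj₁ refl)) , v≡l₂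
  mapStar-∈V⁻ (inj₂ (inj₂ (inj₂ v≡l₃)))      = leaf₃ s , inj₂ (inj₂ (inj₂ refl)) , v≡l₃

  mapStar-∈V⁺ : ∀ {w} → w ∈V s → f w ∈V mapStar f f-inj s
  mapStar-∈V⁺ = Sum.map (cong f) (Sum.map (cong f) (Sum.map (cong f) (cong f)))

vertexDisjoint-sym : {s t : Star n} → VertexDisjoint s t → VertexDisjoint t s
vertexDisjoint-sym apart v (v∈t , v∈s) = apart v (v∈s , v∈t)

isStarSystem? : ∀ n (bs : List (Star n)) → Dec (IsStarSystem n bs)
isStarSystem? n bs = all? λ x → all? λ y → ¬? (x ≟ y) →-dec edgeCount bs x y ℕ.≟ 1

_∈V?_ : ∀ (v : Fin n) s → Dec (v ∈V s)
v ∈V? s = v ≟ centre s ⊎-dec v ≟ leaf₁ s ⊎-dec v ≟ leaf₂ s ⊎-dec v ≟ leaf₃ s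

vertexDisjoint? : (s t : Star n) → Dec (VertexDisjoint s t)
vertexDisjoint? s t = all? λ v → ¬? (v ∈V? s ×-dec v ∈V? t)

isBlockColouring? : ∀ (bs : List (Star n)) k col → Dec (IsBlockColouring bs k col)
isBlockColouring? bs k col = surjective? ×-dec
  (all? λ i → all? λ j → ¬? (i ≟ j) →-dec col i ≟ col j →-dec vertexDisjoint? (lookup bs i) (lookup bs j))
  where
  surjective? = map′ strictlySurjective⇒surjective surjective⇒strictlySurjective
                     (all? λ c → any? λ i → col i ≟ c)

module _ (mk : A → Star n) where

  labelAt : ∀ ℓs → Fin (length (map mk ℓs)) → A
  labelAt (ℓ ∷ ℓs) zero    = ℓ
  labelAt (ℓ ∷ ℓs) (suc i) = labelAt ℓs i

  lookup-map-labelAt : ∀ ℓs i → lookup (map mk ℓs) i ≡ mk (labelAt ℓs i)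
  lookup-map-labelAt (ℓ ∷ ℓs) zero    = refl
  lookup-map-labelAt (ℓ ∷ ℓs) (suc i) = lookup-map-labelAt ℓs i

  labelAt-∈ : ∀ ℓs i → labelAt ℓs i ∈ ℓs
  labelAt-∈ (ℓ ∷ ℓs) zero    = here refl
  labelAt-∈ (ℓ ∷ ℓs) (suc i) = there (labelAt-∈ ℓs i)

  labelAt-injective : ∀ {ℓs} → Unique ℓs → ∀ i j → labelAt ℓs i ≡ labelAt ℓs j → i ≡ j
  labelAt-injective {ℓ ∷ ℓs} _          zero    zero    _  = refl
  labelAt-injective {ℓ ∷ ℓs} (ℓ∉ℓs ∷ _) zero    (suc j) eq = contradiction eq (All.lookup ℓ∉ℓs (labelAt-∈ ℓs j))
  labelAt-injective {ℓ ∷ ℓs} (ℓ∉ℓs ∷ _) (suc i) zero    eq = contradiction (sym eq) (All.lookup ℓ∉ℓs (labelAt-∈ ℓs i))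
  labelAt-injective {ℓ ∷ ℓs} (_ ∷ !ℓs)  (suc i) (suc j) eq = cong suc (labelAt-injective !ℓs i j eq)

  labelAt-surjective : ∀ {ℓs ℓ} → ℓ ∈ ℓs → ∃ λ i → labelAt ℓs i ≡ ℓ
  labelAt-surjective (here refl) = zero , refl
  labelAt-surjective (there ℓ∈ℓs) = let i , eq = labelAt-surjective ℓ∈ℓs in suc i , eq

  blockColourable-map : ∀ {ℓs} → Unique ℓs → (colour : A → Fin k) →
    (∀ c → ∃ λ ℓ → ℓ ∈ ℓs × colour ℓ ≡ c) →
    (∀ {ℓ ℓ′} → ℓ ∈ ℓs → ℓ′ ∈ ℓs → ℓ ≢ ℓ′ → colour ℓ ≡ colour ℓ′ → VertexDisjoint (mk ℓ) (mk ℓ′)) →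
    BlockColourable (map mk ℓs) k
  blockColourable-map {ℓs = ℓs} !ℓs colour onto apart = colour ∘ labelAt ℓs , surjective , disjoint
    where
    surjective = strictlySurjective⇒surjective λ c →
      let ℓ , ℓ∈ℓs , colour≡c = onto c ; i , labelAt≡ℓ = labelAt-surjective ℓ∈ℓs
      in i , trans (cong colour labelAt≡ℓ) colour≡c
    disjoint = λ i j i≢j same-colour →
      subst₂ VertexDisjoint (sym (lookup-map-labelAt ℓs i)) (sym (lookup-map-labelAt ℓs j))
        (apart (labelAt-∈ ℓs i) (labelAt-∈ ℓs j) (i≢j ∘ labelAt-injective !ℓs i j) same-colour)

*+-injective : ∀ {n} .{{_ : NonZero n}} j j′ (r r′ : Fin n) →
  n * j + toℕ r ≡ n * j′ + toℕ r′ → j ≡ j′ × r ≡ r′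
*+-injective {n} j j′ r r′ eq = j≡j′ , r≡r′
  where
  remainder : ∀ j (r : Fin n) → (n * j + toℕ r) % n ≡ toℕ r
  remainder j r = trans (cong (_% n) (trans (+-comm (n * j) (toℕ r)) (cong (toℕ r +_) (*-comm n j))))
                        (trans ([m+kn]%n≡m%n (toℕ r) j n) (m<n⇒m%n≡m (toℕ<n r)))
  r≡r′ : r ≡ r′
  r≡r′ = toℕ-injective (trans (sym (remainder j r)) (trans (cong (_% n) eq) (remainder j′ r′)))
  j≡j′ : j ≡ j′
  j≡j′ = *-cancelˡ-≡ j j′ n (+-cancelʳ-≡ (toℕ r) (n * j) (n * j′)
           (trans eq (cong (λ r → n * j′ + toℕ r) (sym r≡r′))))

even-or-odd : ∀ x → (∃ λ h → x ≡ 2 * h) ⊎ (∃ λ h → x ≡ 1 + 2 * h)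
even-or-odd zero = inj₁ (0 , refl)
even-or-odd (suc x) with even-or-odd x
... | inj₁ (h , refl) = inj₂ (h , refl)
... | inj₂ (h , refl) = inj₁ (suc h , sym (*-suc 2 h))

module Cyclic (m : ℕ) .{{_ : NonZero m}} where

  infixl 6 _⊕_
  infix  8 ⊖_

  _⊕_ : Fin m → Fin m → Fin m
  a ⊕ b = (toℕ a + toℕ b) mod m

  ⊖_ : Fin m → Fin m
  ⊖ a = (m ∸ toℕ a) mod m

  𝟘 : Fin m
  𝟘 = 0 mod m

  toℕ-mod : ∀ x → toℕ (x mod m) ≡ x % m
  toℕ-mod x = toℕ-fromℕ< (m%n<n x m)

  toℕ-𝟘 : toℕ 𝟘 ≡ 0
  toℕ-𝟘 = trans (toℕ-mod 0) (m*n%n≡0 0 m)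

  mod-cong : ∀ {x y} → x % m ≡ y % m → x mod m ≡ y mod m
  mod-cong {x} {y} eq = toℕ-injective (trans (toℕ-mod x) (trans eq (sym (toℕ-mod y))))

  toℕ-mod-id : ∀ (a : Fin m) → toℕ a mod m ≡ a
  toℕ-mod-id a = toℕ-injective (trans (toℕ-mod (toℕ a)) (m<n⇒m%n≡m (toℕ<n a)))

  %-absorbˡ : ∀ x y → (x % m + y) % m ≡ (x + y) % m
  %-absorbˡ x y = begin
    (x % m + y) % m           ≡⟨ %-distribˡ-+ (x % m) y m ⟩
    (x % m % m + y % m) % m   ≡⟨ cong (λ z → (z + y % m) % m) (m%n%n≡m%n x m) ⟩
    (x % m + y % m) % m       ≡⟨ %-distribˡ-+ x y m ⟨
    (x + y) % m               ∎
    where open ≡-Reasoning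

  %-absorbʳ : ∀ x y → (x + y % m) % m ≡ (x + y) % m
  %-absorbʳ x y = trans (cong (_% m) (+-comm x (y % m)))
                        (trans (%-absorbˡ y x) (cong (_% m) (+-comm y x)))

  ⊕-assoc : ∀ a b c → (a ⊕ b) ⊕ c ≡ a ⊕ (b ⊕ c)
  ⊕-assoc a b c = mod-cong (begin
    (toℕ (a ⊕ b) + toℕ c) % m              ≡⟨ cong (λ z → (z + toℕ c) % m) (toℕ-mod (toℕ a + toℕ b)) ⟩
    ((toℕ a + toℕ b) % m + toℕ c) % m      ≡⟨ %-absorbˡ (toℕ a + toℕ b) (toℕ c) ⟩
    (toℕ a + toℕ b + toℕ c) % m            ≡⟨ cong (_% m) (+-assoc (toℕ a) (toℕ b) (toℕ c)) ⟩
    (toℕ a + (toℕ b + toℕ c)) % m          ≡⟨ %-absorbʳ (toℕ a) (toℕ b + toℕ c) ⟨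
    (toℕ a + (toℕ b + toℕ c) % m) % m      ≡⟨ cong (λ z → (toℕ a + z) % m) (toℕ-mod (toℕ b + toℕ c)) ⟨
    (toℕ a + toℕ (b ⊕ c)) % m              ∎)
    where open ≡-Reasoning

  ⊕-comm : ∀ a b → a ⊕ b ≡ b ⊕ a
  ⊕-comm a b = cong (_mod m) (+-comm (toℕ a) (toℕ b))

  ⊕-identityˡ : ∀ a → 𝟘 ⊕ a ≡ a
  ⊕-identityˡ a = trans (cong (λ z → (z + toℕ a) mod m) toℕ-𝟘) (toℕ-mod-id a)

  ⊖-inverseˡ : ∀ a → ⊖ a ⊕ a ≡ 𝟘
  ⊖-inverseˡ a = mod-cong (begin
    (toℕ (⊖ a) + toℕ a) % m             ≡⟨ cong (λ z → (z + toℕ a) % m) (toℕ-mod (m ∸ toℕ a)) ⟩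
    ((m ∸ toℕ a) % m + toℕ a) % m       ≡⟨ %-absorbˡ (m ∸ toℕ a) (toℕ a) ⟩
    (m ∸ toℕ a + toℕ a) % m             ≡⟨ cong (_% m) (m∸n+n≡m (<⇒≤ (toℕ<n a))) ⟩
    m % m                               ≡⟨ n%n≡0 m ⟩
    0                                   ≡⟨ m*n%n≡0 0 m ⟨
    0 % m                               ∎)
    where open ≡-Reasoning

  ⊕-identityʳ : ∀ a → a ⊕ 𝟘 ≡ a
  ⊕-identityʳ a = trans (⊕-comm a 𝟘) (⊕-identityˡ a)

  ⊖-inverseʳ : ∀ a → a ⊕ ⊖ a ≡ 𝟘
  ⊖-inverseʳ a = trans (⊕-comm a (⊖ a)) (⊖-inverseˡ a)

  isAbelianGroup : IsAbelianGroup _≡_ _⊕_ 𝟘 ⊖_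
  isAbelianGroup = record
    { isGroup = record
      { isMonoid = record
        { isSemigroup = record { isMagma = record { isEquivalence = isEquivalence ; ∙-cong = cong₂ _⊕_ }
                               ; assoc = ⊕-assoc }
        ; identity = ⊕-identityˡ , ⊕-identityʳ }
      ; inverse = ⊖-inverseˡ , ⊖-inverseʳ
      ; ⁻¹-cong = cong ⊖_ }
    ; comm = ⊕-comm }

  toℕ-⊖ : ∀ a → a ≢ 𝟘 → toℕ (⊖ a) ≡ m ∸ toℕ a
  toℕ-⊖ a a≢𝟘 = trans (toℕ-mod (m ∸ toℕ a)) (m<n⇒m%n≡m (∸-monoʳ-< 0<a (<⇒≤ (toℕ<n a))))
    where
    0<a : 0 < toℕ a
    0<a = n≢0⇒n>0 λ a≡0 → a≢𝟘 (toℕ-injective (trans a≡0 (sym toℕ-𝟘)))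

  toℕ-⊕ : ∀ a b → toℕ a + toℕ b < m → toℕ (a ⊕ b) ≡ toℕ a + toℕ b
  toℕ-⊕ a b a+b<m = trans (toℕ-mod (toℕ a + toℕ b)) (m<n⇒m%n≡m a+b<m)

  ℤ/m : AbelianGroup 0ℓ 0ℓ
  ℤ/m = record { isAbelianGroup = isAbelianGroup }

  open Algebra.Properties.AbelianGroup ℤ/m public

module Development (m k : ℕ) .{{_ : NonZero m}} where

  open Cyclic m

  -- Opaque so that type checking never unfolds combine and remQuot, which is very costly.
  opaque
    vertex : Fin m → Fin k → Fin (m * k)
    vertex = combine

    cell : Fin (m * k) → Fin m
    cell v = proj₁ (remQuot {m} k v)

    slot : Fin (m * k) → Fin k
    slot v = proj₂ (remQuot {m} k v)

    vertex-cell-slot : ∀ v → vertex (cell v) (slot v) ≡ v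
    vertex-cell-slot = combine-remQuot {m} k

    cell-vertex : ∀ a s → cell (vertex a s) ≡ a
    cell-vertex a s = cong proj₁ (remQuot-combine {m} {k} a s)

    slot-vertex : ∀ a s → slot (vertex a s) ≡ s
    slot-vertex a s = cong proj₂ (remQuot-combine {m} {k} a s)

    vertex-injective : ∀ {a b s t} → vertex a s ≡ vertex b t → a ≡ b × s ≡ t
    vertex-injective = combine-injective _ _ _ _

  cell≢ : ∀ {a b s t} → a ≢ b → vertex a s ≢ vertex b t
  cell≢ a≢b = a≢b ∘ proj₁ ∘ vertex-injective

  slot≢ : ∀ {a b s t} → s ≢ t → vertex a s ≢ vertex b t
  slot≢ s≢t = s≢t ∘ proj₂ ∘ vertex-injective

  starAt : (c l₁ l₂ l₃ : Fin m × Fin k) → c ≢ l₁ → c ≢ l₂ → c ≢ l₃ → l₁ ≢ l₂ → l₁ ≢ l₃ → l₂ ≢ l₃ →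
    Star (m * k)
  starAt c l₁ l₂ l₃ c≢₁ c≢₂ c≢₃ 1≢2 1≢3 2≢3 = star (at c) (at l₁) (at l₂) (at l₃)
    (c≢₁ ∘ at-injective) (c≢₂ ∘ at-injective) (c≢₃ ∘ at-injective)
    (1≢2 ∘ at-injective) (1≢3 ∘ at-injective) (2≢3 ∘ at-injective)
    where
    at = uncurry vertex
    at-injective : ∀ {p p′} → at p ≡ at p′ → p ≡ p′
    at-injective eq = let a≡b , s≡t = vertex-injective eq in cong₂ _,_ a≡b s≡t

  χ-vertex : ∀ a b s t → χ (vertex a s ≟ vertex b t) ≡ χ (a ≟ b) * χ (s ≟ t)
  χ-vertex a b s t with a ≟ b | s ≟ t
  ... | yes refl | yes refl = χ-yes (_ ≟ _) refl
  ... | yes _    | no s≢t   = χ-no (_ ≟ _) (slot≢ s≢t)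
  ... | no a≢b   | _        = χ-no (_ ≟ _) (cell≢ a≢b)

  translate : Fin m → Fin (m * k) → Fin (m * k)
  translate c v = vertex (c ⊕ cell v) (slot v)

  translate-vertex : ∀ c a s → translate c (vertex a s) ≡ vertex (c ⊕ a) s
  translate-vertex c a s = cong₂ (λ a s → vertex (c ⊕ a) s) (cell-vertex a s) (slot-vertex a s)

  translate-translate : ∀ c d v → translate c (translate d v) ≡ translate (c ⊕ d) v
  translate-translate c d v =
    trans (translate-vertex c (d ⊕ cell v) (slot v)) (cong (λ a → vertex a (slot v)) (sym (⊕-assoc c d (cell v))))

  translate-𝟘 : ∀ v → translate 𝟘 v ≡ v
  translate-𝟘 v = trans (cong (λ a → vertex a (slot v)) (⊕-identityˡ (cell v))) (vertex-cell-slot v)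

  translate-inverseˡ : ∀ c v → translate (⊖ c) (translate c v) ≡ v
  translate-inverseˡ c v =
    trans (translate-translate (⊖ c) c v) (trans (cong (λ a → translate a v) (⊖-inverseˡ c)) (translate-𝟘 v))

  translate-inverseʳ : ∀ c v → translate c (translate (⊖ c) v) ≡ v
  translate-inverseʳ c v =
    trans (translate-translate c (⊖ c) v) (trans (cong (λ a → translate a v) (⊖-inverseʳ c)) (translate-𝟘 v))

  translate-injective : ∀ c → Injective _≡_ _≡_ (translate c)
  translate-injective c {v} {w} eq =
    trans (sym (translate-inverseˡ c v)) (trans (cong (translate (⊖ c)) eq) (translate-inverseˡ c w))

  translateStar : Fin m → Star (m * k) → Star (m * k)
  translateStar c = mapStar (translate c) (translate-injective c)

  incidence-translateStar : ∀ c β x y →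
    incidence (translateStar c β) x y ≡ incidence β (translate (⊖ c) x) (translate (⊖ c) y)
  incidence-translateStar c β x y =
    trans (cong₂ (incidence (translateStar c β)) (sym (translate-inverseʳ c x)) (sym (translate-inverseʳ c y)))
          (incidence-mapStar (translate-injective c) β _ _)

  relative : Fin (m * k) → Fin (m * k) → Fin (m * k)
  relative x = translate (⊖ cell x)

  relative-self : ∀ x → relative x x ≡ vertex 𝟘 (slot x)
  relative-self x = cong (λ a → vertex a (slot x)) (⊖-inverseˡ (cell x))

  ∑-incidence-orbit : ∀ β x y → cell (centre β) ≡ 𝟘 →
    ∑[ c ∈ allFin m ] incidence (translateStar c β) x y ≡ incidence β (relative x x) (relative x y)
  ∑-incidence-orbit β x y centred =
    trans (∑-single (Unique.allFin⁺ m) (∈-allFin (cell x)) elsewhere) (incidence-translateStar (cell x) β x y)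
    where
    elsewhere : ∀ {c} → c ∈ allFin m → c ≢ cell x → incidence (translateStar c β) x y ≡ 0
    elsewhere {c} _ c≢x rewrite incidence-translateStar c β x y =
      cong (_* _) (χ-no (_ ≟ _) λ centre≡ → c≢x (⁻¹-injective (inverseˡ-unique (⊖ c) (cell x) (begin
        ⊖ c ⊕ cell x                       ≡⟨ cell-vertex (⊖ c ⊕ cell x) (slot x) ⟨
        cell (translate (⊖ c) x)           ≡⟨ cong cell centre≡ ⟨
        cell (centre β)                    ≡⟨ centred ⟩
        𝟘                                  ∎))))
      where open ≡-Reasoning

  module _ {I : Set} (base : I → Star (m * k)) (is : List I) where

    development : List (Star (m * k))
    development = map (λ (i , c) → translateStar c (base i)) (cartesianProduct is (allFin m))

    arcs : Fin k → Fin (m * k) → ℕ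
    arcs s v = ∑[ i ∈ is ] incidence (base i) (vertex 𝟘 s) v

    IsDifferenceFamily : Set
    IsDifferenceFamily = ∀ s d t → vertex 𝟘 s ≢ vertex d t → arcs s (vertex d t) + arcs t (vertex (⊖ d) s) ≡ 1

    development-isStarSystem : (∀ i → cell (centre (base i)) ≡ 𝟘) → IsDifferenceFamily →
      IsStarSystem (m * k) development
    development-isStarSystem centred family x y x≢y = begin
      edgeCount development x y
        ≡⟨ edgeCount-map _ (cartesianProduct is (allFin m)) x y ⟩
      ∑[ (i , c) ∈ cartesianProduct is (allFin m) ] edgeMult (translateStar c (base i)) x y
        ≡⟨ ∑-cong (cartesianProduct is (allFin m))
                  (λ (i , c) → edgeMult-incidence (translateStar c (base i)) x y x≢y) ⟩
      ∑[ (i , c) ∈ cartesianProduct is (allFin m) ]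
        (incidence (translateStar c (base i)) x y + incidence (translateStar c (base i)) y x)
        ≡⟨ ∑-+ (cartesianProduct is (allFin m)) _ _ ⟩
      orbitSum x y + orbitSum y x
        ≡⟨ cong₂ _+_ (orbitSum≡arcs x y) (orbitSum≡arcs y x) ⟩
      arcs (slot x) (vertex d (slot y)) + arcs (slot y) (vertex (⊖ cell y ⊕ cell x) (slot x))
        ≡⟨ cong (λ e → arcs (slot x) (vertex d (slot y)) + arcs (slot y) (vertex e (slot x)))
                (⁻¹-anti-homo-\\ (cell x) (cell y)) ⟨
      arcs (slot x) (vertex d (slot y)) + arcs (slot y) (vertex (⊖ d) (slot x))
        ≡⟨ family (slot x) d (slot y) (x≢y ∘ translate-injective (⊖ cell x) ∘ trans (relative-self x)) ⟩
      1 ∎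
      where
      open ≡-Reasoning
      d = ⊖ cell x ⊕ cell y
      orbitSum : Fin (m * k) → Fin (m * k) → ℕ
      orbitSum x y = ∑[ (i , c) ∈ cartesianProduct is (allFin m) ] incidence (translateStar c (base i)) x y
      orbitSum≡arcs : ∀ x y → orbitSum x y ≡ arcs (slot x) (relative x y)
      orbitSum≡arcs x y = trans (∑-cartesianProduct is (allFin m) _) (∑-cong is λ i →
        trans (∑-incidence-orbit (base i) x y (centred i))
              (cong (λ v → incidence (base i) v (relative x y)) (relative-self x)))

  translateStar-∈V : ∀ c a s {v} → v ∈V translateStar (c ⊕ a) s → translate (⊖ c) v ∈V translateStar a s
  translateStar-∈V c a s v∈ =
    let w , w∈s , v≡ = mapStar-∈V⁻ (translate-injective (c ⊕ a)) s v∈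
    in  subst (_∈V translateStar a s) (sym (shift v≡)) (mapStar-∈V⁺ (translate-injective a) s w∈s)
    where
    shift : ∀ {v w} → v ≡ translate (c ⊕ a) w → translate (⊖ c) v ≡ translate a w
    shift {w = w} refl =
      trans (translate-translate (⊖ c) (c ⊕ a) w) (cong (λ e → translate e w) (\\-leftDividesʳ c a))

  translateStar-disjoint : ∀ c {a b s t} → VertexDisjoint (translateStar a s) (translateStar b t) →
    VertexDisjoint (translateStar (c ⊕ a) s) (translateStar (c ⊕ b) t)
  translateStar-disjoint c {a} {b} {s} {t} apart v (v∈s , v∈t) =
    apart (translate (⊖ c) v) (translateStar-∈V c a s v∈s , translateStar-∈V c b t v∈t)

  translateStar-cell : ∀ a s {v} → v ∈V translateStar a s → ∃ λ w → w ∈V s × cell v ≡ a ⊕ cell w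
  translateStar-cell a s v∈ =
    let w , w∈s , v≡ = mapStar-∈V⁻ (translate-injective a) s v∈
    in w , w∈s , trans (cong cell v≡) (cell-vertex (a ⊕ cell w) (slot w))

  Occupies : Star (m * k) → ℕ → Set
  Occupies N c = ∀ {v} → v ∈V N → c ≤ toℕ (cell v) × toℕ (cell v) ≤ suc c

  occupies-apart : ∀ {N N′ c c′} → Occupies N c → Occupies N′ c′ → 2 + c ≤ c′ → VertexDisjoint N N′
  occupies-apart occ occ′ gap v (v∈ , v∈′) = <⇒≱ gap (≤-trans (proj₁ (occ′ v∈′)) (proj₂ (occ v∈)))

-- Order 9

stars9 : List (Star 9)
stars9 =
  star (# 7) (# 0) (# 1) (# 6) (λ ()) (λ ()) (λ ()) (λ ()) (λ ()) (λ ()) ∷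
  star (# 4) (# 6) (# 7) (# 2) (λ ()) (λ ()) (λ ()) (λ ()) (λ ()) (λ ()) ∷
  star (# 2) (# 7) (# 3) (# 1) (λ ()) (λ ()) (λ ()) (λ ()) (λ ()) (λ ()) ∷
  star (# 7) (# 8) (# 3) (# 5) (λ ()) (λ ()) (λ ()) (λ ()) (λ ()) (λ ()) ∷
  star (# 1) (# 4) (# 0) (# 6) (λ ()) (λ ()) (λ ()) (λ ()) (λ ()) (λ ()) ∷
  star (# 3) (# 8) (# 6) (# 0) (λ ()) (λ ()) (λ ()) (λ ()) (λ ()) (λ ()) ∷
  star (# 4) (# 8) (# 3) (# 5) (λ ()) (λ ()) (λ ()) (λ ()) (λ ()) (λ ()) ∷
  star (# 0) (# 8) (# 5) (# 4) (λ ()) (λ ()) (λ ()) (λ ()) (λ ()) (λ ()) ∷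
  star (# 5) (# 8) (# 3) (# 2) (λ ()) (λ ()) (λ ()) (λ ()) (λ ()) (λ ()) ∷
  star (# 6) (# 8) (# 0) (# 5) (λ ()) (λ ()) (λ ()) (λ ()) (λ ()) (λ ()) ∷
  star (# 1) (# 8) (# 3) (# 5) (λ ()) (λ ()) (λ ()) (λ ()) (λ ()) (λ ()) ∷
  star (# 2) (# 6) (# 8) (# 0) (λ ()) (λ ()) (λ ()) (λ ()) (λ ()) (λ ()) ∷ []

colouring9 : Fin 12 → Fin 8
colouring9 = lookup (# 0 ∷ # 1 ∷ # 2 ∷ # 3 ∷ # 3 ∷ # 4 ∷ # 0 ∷ # 2 ∷ # 5 ∷ # 6 ∷ # 1 ∷ # 7 ∷ [])

system9 : Σ (List (Star 9)) (λ bs → IsStarSystem 9 bs × BlockColourable bs 8)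
system9 = stars9 , toWitness {a? = isStarSystem? 9 stars9} _
        , colouring9 , toWitness {a? = isBlockColouring? stars9 8 colouring9} _

module Construction (q′ : ℕ) where

  q : ℕ
  q = suc q′

  m : ℕ
  m = 3 + q * 4

  open Cyclic m
  open Development m 3

  1ₘ : Fin m
  1ₘ = suc zero

  2ₘ 3ₘ : Fin m
  2ₘ = suc (suc zero)
  3ₘ = suc (suc (suc zero))

  K : ℕ
  K = suc (2 * q)

  m≡1+2K : m ≡ 1 + 2 * K
  m≡1+2K = ring q′
    where
    ring : ∀ a → 3 + suc a * 4 ≡ 1 + 2 * suc (2 * suc a)
    ring = solve-∀

  oddCell< : ∀ (i : Fin K) → 1 + 2 * toℕ i < m
  oddCell< i = s≤s (s≤s (begin
    2 * toℕ i        ≤⟨ *-monoʳ-≤ 2 (s≤s⁻¹ (toℕ<n i)) ⟩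
    2 * (2 * q)      ≤⟨ m≤m+n _ 1 ⟩
    2 * (2 * q) + 1  ≡⟨ ring q ⟩
    1 + q * 4        ∎))
    where
    open ≤-Reasoning
    ring : ∀ a → 2 * (2 * a) + 1 ≡ 1 + a * 4
    ring = solve-∀

  oddCell : Fin K → Fin m
  oddCell i = fromℕ< (oddCell< i)

  toℕ-oddCell : ∀ i → toℕ (oddCell i) ≡ 1 + 2 * toℕ i
  toℕ-oddCell i = toℕ-fromℕ< (oddCell< i)

  oddCell≢𝟘 : ∀ i → oddCell i ≢ 𝟘
  oddCell≢𝟘 i eq with () ← trans (sym (toℕ-oddCell i)) (cong toℕ eq)

  toℕ-⊖1ₘ : toℕ (⊖ 1ₘ) ≡ 2 + q * 4
  toℕ-⊖1ₘ = toℕ-⊖ 1ₘ λ ()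

  ⊖1ₘ≢𝟘 : ⊖ 1ₘ ≢ 𝟘
  ⊖1ₘ≢𝟘 eq with () ← trans (sym toℕ-⊖1ₘ) (cong toℕ eq)

  ⊖1ₘ≢1ₘ : ⊖ 1ₘ ≢ 1ₘ
  ⊖1ₘ≢1ₘ eq with () ← trans (sym toℕ-⊖1ₘ) (cong toℕ eq)

  2ₘ≢3ₘ : 2ₘ ≢ 3ₘ
  2ₘ≢3ₘ ()

  half-bound : ∀ {d h} → toℕ d ≡ 1 + 2 * h → h < K
  half-bound {d} {h} d≡1+2h =
    *-cancelˡ-< 2 h K (s≤s⁻¹ (subst (λ z → 1 + 2 * h < z) m≡1+2K (subst (_< m) d≡1+2h (toℕ<n d))))

  toℕ-⊖-odd : ∀ d h → toℕ d ≡ 1 + 2 * h → toℕ (⊖ d) ≡ 2 * (K ∸ h)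
  toℕ-⊖-odd d h d≡1+2h = begin
    toℕ (⊖ d)                  ≡⟨ toℕ-⊖ d d≢𝟘 ⟩
    m ∸ toℕ d                  ≡⟨ cong₂ _∸_ m≡1+2K d≡1+2h ⟩
    (1 + 2 * K) ∸ (1 + 2 * h)  ≡⟨ *-distribˡ-∸ 2 K h ⟨
    2 * (K ∸ h)                ∎
    where
    open ≡-Reasoning
    d≢𝟘 : d ≢ 𝟘
    d≢𝟘 d≡𝟘 with () ← trans (sym d≡1+2h) (cong toℕ d≡𝟘)

  toℕ-⊖-even : ∀ d h → d ≢ 𝟘 → toℕ d ≡ 2 * h → toℕ (⊖ d) ≡ 1 + 2 * (K ∸ h)
  toℕ-⊖-even d h d≢𝟘 d≡2h = begin
    toℕ (⊖ d)                  ≡⟨ toℕ-⊖ d d≢𝟘 ⟩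
    m ∸ toℕ d                  ≡⟨ cong₂ _∸_ m≡1+2K d≡2h ⟩
    (1 + 2 * K) ∸ 2 * h        ≡⟨ +-∸-assoc 1 2h≤2K ⟩
    1 + (2 * K ∸ 2 * h)        ≡⟨ cong (1 +_) (*-distribˡ-∸ 2 K h) ⟨
    1 + 2 * (K ∸ h)            ∎
    where
    open ≡-Reasoning
    2h≤2K : 2 * h ≤ 2 * K
    2h≤2K = s≤s⁻¹ (subst (λ z → 2 * h < z) m≡1+2K (subst (_< m) d≡2h (toℕ<n d)))

  fanStar : Fin 3 → (δ : Fin m) → δ ≢ 𝟘 → Star (m * 3)
  fanStar s δ δ≢𝟘 = starAt (𝟘 , s) (δ , 0F) (δ , 1F) (δ , 2F) c≢l c≢l c≢l (λ ()) (λ ()) (λ ())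
    where
    c≢l : ∀ {σ} → (𝟘 , s) ≢ (δ , σ)
    c≢l = δ≢𝟘 ∘ sym ∘ cong proj₁

  data Base : Set where
    fan         : Fin 3 → Fin K → Base
    starA starB : Base

  baseStar : Base → Star (m * 3)
  baseStar (fan s i) = fanStar s (oddCell i) (oddCell≢𝟘 i)
  baseStar starA = starAt (𝟘 , 0F) (𝟘 , 1F) (𝟘 , 2F) (⊖ 1ₘ , 1F)
    (λ ()) (λ ()) (λ ()) (λ ()) (⊖1ₘ≢𝟘 ∘ sym ∘ cong proj₁) (λ ())
  baseStar starB = starAt (𝟘 , 1F) (𝟘 , 2F) (1ₘ , 1F) (1ₘ , 2F) (λ ()) (λ ()) (λ ()) (λ ()) (λ ()) (λ ())

  -- The fan with slot 1 and difference 1 is replaced by starB.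
  notExcluded? : ∀ (p : Fin 3 × Fin K) → Dec (p ≢ (1F , zero))
  notExcluded? p = ¬? (≡-dec _≟_ _≟_ p (1F , zero))

  fanIndices : List (Fin 3 × Fin K)
  fanIndices = filter notExcluded? (cartesianProduct (allFin 3) (allFin K))

  bases : List Base
  bases = starA ∷ starB ∷ map (uncurry fan) fanIndices

  unique-fanIndices : Unique fanIndices
  unique-fanIndices =
    Unique.filter⁺ notExcluded? (Unique.cartesianProduct⁺ (Unique.allFin⁺ 3) (Unique.allFin⁺ K))

  unique-bases : Unique bases
  unique-bases = ((λ ()) ∷ AllP.map⁺ (All.universal (λ _ ()) fanIndices))
               ∷ (AllP.map⁺ (All.universal (λ _ ()) fanIndices))
               ∷ Unique.map⁺ (λ { refl → refl }) unique-fanIndices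

  fan∈bases : ∀ {s i} → (s , i) ≢ (1F , zero) → fan s i ∈ bases
  fan∈bases kept = there (there (∈-map⁺ (uncurry fan)
    (∈-filter⁺ notExcluded? (∈-cartesianProduct⁺ (∈-allFin _) (∈-allFin _)) kept)))

  fan∈bases⇒kept : ∀ {s i} → fan s i ∈ bases → (s , i) ≢ (1F , zero)
  fan∈bases⇒kept (there (there p)) with ∈-map⁻ (uncurry fan) p
  ... | _ , p∈ , refl = proj₂ (∈-filter⁻ notExcluded? {xs = cartesianProduct (allFin 3) (allFin K)} p∈)

  centred : ∀ τ → cell (centre (baseStar τ)) ≡ 𝟘
  centred (fan s _) = cell-vertex 𝟘 s
  centred starA     = cell-vertex 𝟘 0F
  centred starB     = cell-vertex 𝟘 1F

  baseArcs : Fin 3 → Fin (m * 3) → ℕ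
  baseArcs = arcs baseStar bases

  -- Every edge is covered exactly once

  fanArcs : Fin 3 → Fin m → ℕ
  fanArcs s d = ∑[ (s′ , i) ∈ fanIndices ] χ (s′ ≟ s ×-dec oddCell i ≟ d)

  fanArcs-even : ∀ s d h → toℕ d ≡ 2 * h → fanArcs s d ≡ 0
  fanArcs-even s d h d≡2h = ∑-χ-none (λ (s′ , i) → s′ ≟ s ×-dec oddCell i ≟ d) fanIndices
    λ {(s′ , i)} _ (_ , i↦d) →
      even≢odd h (toℕ i) (trans (sym d≡2h) (trans (cong toℕ (sym i↦d)) (toℕ-oddCell i)))

  fanArcs-odd : ∀ s d h → toℕ d ≡ 1 + 2 * h → (s , h) ≢ (1F , 0) → fanArcs s d ≡ 1
  fanArcs-odd s d h d≡1+2h not-excluded = ∑-χ-unique (λ (s′ , i) → s′ ≟ s ×-dec oddCell i ≟ d)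
    unique-fanIndices (∈-filter⁺ notExcluded? (∈-cartesianProduct⁺ (∈-allFin s) (∈-allFin i₀)) i₀-kept)
    (refl , toℕ-injective (trans (toℕ-oddCell i₀) (trans (cong (λ z → 1 + 2 * z) toℕ-i₀) (sym d≡1+2h))))
    λ {(s′ , i)} _ (s′≡s , i↦d) → cong₂ _,_ s′≡s (toℕ-injective (trans (half i↦d) (sym toℕ-i₀)))
    where
    i₀ : Fin K
    i₀ = fromℕ< (half-bound {d} d≡1+2h)
    toℕ-i₀ : toℕ i₀ ≡ h
    toℕ-i₀ = toℕ-fromℕ< (half-bound {d} d≡1+2h)
    i₀-kept : (s , i₀) ≢ (1F , zero)
    i₀-kept eq = let s≡1 , i₀≡0 = ,-injective eq in
      not-excluded (cong₂ _,_ s≡1 (trans (sym toℕ-i₀) (cong toℕ i₀≡0)))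
    half : ∀ {i} → oddCell i ≡ d → toℕ i ≡ h
    half {i} i↦d = *-cancelˡ-≡ (toℕ i) h 2
      (suc-injective (trans (sym (toℕ-oddCell i)) (trans (cong toℕ i↦d) d≡1+2h)))

  fanArcs-excluded : fanArcs 1F 1ₘ ≡ 0
  fanArcs-excluded = ∑-χ-none (λ (s′ , i) → s′ ≟ 1F ×-dec oddCell i ≟ 1ₘ) fanIndices
    λ {(s′ , i)} p∈ (s′≡1 , i↦1) → proj₂ (∈-filter⁻ notExcluded? {xs = cartesianProduct (allFin 3) (allFin K)} p∈)
      (cong₂ _,_ s′≡1 (toℕ-injective (*-cancelˡ-≡ (toℕ i) 0 2
        (suc-injective (trans (sym (toℕ-oddCell i)) (cong toℕ i↦1))))))

  fanArcs-1ₘ : ∀ s → fanArcs s 1ₘ ≡ χ (¬? (s ≟ 1F))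
  fanArcs-1ₘ 0F = fanArcs-odd 0F 1ₘ 0 refl λ ()
  fanArcs-1ₘ 1F = fanArcs-excluded
  fanArcs-1ₘ 2F = fanArcs-odd 2F 1ₘ 0 refl λ ()

  exactly-one-slot : ∀ (t : Fin 3) → χ (0F ≟ t) + χ (1F ≟ t) + χ (2F ≟ t) ≡ 1
  exactly-one-slot 0F = refl
  exactly-one-slot 1F = refl
  exactly-one-slot 2F = refl

  incidence-fan : ∀ s′ i s d t →
    incidence (baseStar (fan s′ i)) (vertex 𝟘 s) (vertex d t) ≡ χ (s′ ≟ s ×-dec oddCell i ≟ d)
  incidence-fan s′ i s d t = begin
    incidence (baseStar (fan s′ i)) (vertex 𝟘 s) (vertex d t)
      ≡⟨ cong₂ _*_ (χ-vertex 𝟘 𝟘 s′ s)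
                   (cong₂ _+_ (cong₂ _+_ (χ-vertex δ d 0F t) (χ-vertex δ d 1F t)) (χ-vertex δ d 2F t)) ⟩
    1 * χ (s′ ≟ s) * (χ (δ ≟ d) * χ (0F ≟ t) + χ (δ ≟ d) * χ (1F ≟ t) + χ (δ ≟ d) * χ (2F ≟ t))
      ≡⟨ factor (χ (s′ ≟ s)) (χ (δ ≟ d)) (χ (0F ≟ t)) (χ (1F ≟ t)) (χ (2F ≟ t)) ⟩
    χ (s′ ≟ s) * χ (δ ≟ d) * (χ (0F ≟ t) + χ (1F ≟ t) + χ (2F ≟ t))
      ≡⟨ cong (χ (s′ ≟ s) * χ (δ ≟ d) *_) (exactly-one-slot t) ⟩
    χ (s′ ≟ s) * χ (δ ≟ d) * 1
      ≡⟨ trans (*-identityʳ _) (sym (χ-× (s′ ≟ s) (δ ≟ d))) ⟩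
    χ (s′ ≟ s ×-dec δ ≟ d) ∎
    where
    open ≡-Reasoning
    δ = oddCell i
    factor : ∀ a b x y z → 1 * a * (b * x + b * y + b * z) ≡ a * b * (x + y + z)
    factor = solve-∀

  arcsA arcsB specialArcs : Fin 3 → Fin m → Fin 3 → ℕ
  arcsA s d t = χ (0F ≟ s) * (χ (𝟘 ≟ d) * χ (1F ≟ t) + χ (𝟘 ≟ d) * χ (2F ≟ t) + χ (⊖ 1ₘ ≟ d) * χ (1F ≟ t))
  arcsB s d t = χ (1F ≟ s) * (χ (𝟘 ≟ d) * χ (2F ≟ t) + χ (1ₘ ≟ d) * χ (1F ≟ t) + χ (1ₘ ≟ d) * χ (2F ≟ t))
  specialArcs s d t = arcsA s d t + arcsB s d t

  arcs≡ : ∀ s d t → baseArcs s (vertex d t) ≡ specialArcs s d t + fanArcs s d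
  arcs≡ s d t = trans (cong₂ _+_ starA-arcs (cong₂ _+_ starB-arcs fan-arcs))
                      (sym (+-assoc (arcsA s d t) (arcsB s d t) (fanArcs s d)))
    where
    starA-arcs : incidence (baseStar starA) (vertex 𝟘 s) (vertex d t) ≡ arcsA s d t
    starA-arcs = cong₂ _*_ (trans (χ-vertex 𝟘 𝟘 0F s) (*-identityˡ _))
      (cong₂ _+_ (cong₂ _+_ (χ-vertex 𝟘 d 1F t) (χ-vertex 𝟘 d 2F t)) (χ-vertex (⊖ 1ₘ) d 1F t))
    starB-arcs : incidence (baseStar starB) (vertex 𝟘 s) (vertex d t) ≡ arcsB s d t
    starB-arcs = cong₂ _*_ (trans (χ-vertex 𝟘 𝟘 1F s) (*-identityˡ _))
      (cong₂ _+_ (cong₂ _+_ (χ-vertex 𝟘 d 2F t) (χ-vertex 1ₘ d 1F t)) (χ-vertex 1ₘ d 2F t))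
    fan-arcs = trans (∑-map (uncurry fan) fanIndices (λ τ → incidence (baseStar τ) (vertex 𝟘 s) (vertex d t)))
                     (∑-cong fanIndices λ (s′ , i) → incidence-fan s′ i s d t)

  arcs-pair : ∀ s d t d′ → baseArcs s (vertex d t) + baseArcs t (vertex d′ s) ≡
    (specialArcs s d t + specialArcs t d′ s) + (fanArcs s d + fanArcs t d′)
  arcs-pair s d t d′ = trans (cong₂ _+_ (arcs≡ s d t) (arcs≡ t d′ s))
    (shuffle (specialArcs s d t) (fanArcs s d) (specialArcs t d′ s) (fanArcs t d′))
    where
    shuffle : ∀ a b c e → a + b + (c + e) ≡ a + c + (b + e)
    shuffle = solve-∀

  specialArcs-𝟘 : ∀ s t → s ≢ t → specialArcs s 𝟘 t + specialArcs t 𝟘 s ≡ 1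
  specialArcs-𝟘 s t s≢t rewrite χ-no (⊖ 1ₘ ≟ 𝟘) ⊖1ₘ≢𝟘 with s | t
  ... | 0F | 0F = contradiction refl s≢t
  ... | 0F | 1F = refl
  ... | 0F | 2F = refl
  ... | 1F | 0F = refl
  ... | 1F | 1F = contradiction refl s≢t
  ... | 1F | 2F = refl
  ... | 2F | 0F = refl
  ... | 2F | 1F = refl
  ... | 2F | 2F = contradiction refl s≢t

  specialArcs-1ₘ : ∀ s t → specialArcs s 1ₘ t + specialArcs t (⊖ 1ₘ) s + χ (¬? (s ≟ 1F)) ≡ 1
  specialArcs-1ₘ s t rewrite χ-no (⊖ 1ₘ ≟ 1ₘ) ⊖1ₘ≢1ₘ | χ-no (𝟘 ≟ ⊖ 1ₘ) (⊖1ₘ≢𝟘 ∘ sym)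
                           | χ-no (1ₘ ≟ ⊖ 1ₘ) (⊖1ₘ≢1ₘ ∘ sym) | χ-yes (⊖ 1ₘ ≟ ⊖ 1ₘ) refl with s | t
  ... | 0F | 0F = refl
  ... | 0F | 1F = refl
  ... | 0F | 2F = refl
  ... | 1F | 0F = refl
  ... | 1F | 1F = refl
  ... | 1F | 2F = refl
  ... | 2F | 0F = refl
  ... | 2F | 1F = refl
  ... | 2F | 2F = refl

  specialArcs-far : ∀ s d t → d ≢ 𝟘 → d ≢ 1ₘ → d ≢ ⊖ 1ₘ → specialArcs s d t ≡ 0
  specialArcs-far s d t d≢𝟘 d≢1ₘ d≢-1ₘ
    rewrite χ-no (𝟘 ≟ d) (d≢𝟘 ∘ sym) | χ-no (1ₘ ≟ d) (d≢1ₘ ∘ sym) | χ-no (⊖ 1ₘ ≟ d) (d≢-1ₘ ∘ sym)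
          | *-zeroʳ (χ (0F ≟ s)) | *-zeroʳ (χ (1F ≟ s)) = refl

  -- Fans see exactly the odd differences (but 1 from slot 1), the special stars 0 and ±1.
  odd-difference : ∀ s d t h → toℕ d ≡ 1 + 2 * h →
    baseArcs s (vertex d t) + baseArcs t (vertex (⊖ d) s) ≡ 1
  odd-difference s d t zero d≡1 with refl ← toℕ-injective {i = d} {j = 1ₘ} d≡1 = begin
    baseArcs s (vertex 1ₘ t) + baseArcs t (vertex (⊖ 1ₘ) s)
      ≡⟨ arcs-pair s 1ₘ t (⊖ 1ₘ) ⟩
    specialArcs s 1ₘ t + specialArcs t (⊖ 1ₘ) s + (fanArcs s 1ₘ + fanArcs t (⊖ 1ₘ))
      ≡⟨ cong₂ (λ a b → specialArcs s 1ₘ t + specialArcs t (⊖ 1ₘ) s + (a + b))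
               (fanArcs-1ₘ s) (fanArcs-even t (⊖ 1ₘ) K (toℕ-⊖-odd 1ₘ 0 refl)) ⟩
    specialArcs s 1ₘ t + specialArcs t (⊖ 1ₘ) s + (χ (¬? (s ≟ 1F)) + 0)
      ≡⟨ cong (specialArcs s 1ₘ t + specialArcs t (⊖ 1ₘ) s +_) (+-identityʳ _) ⟩
    specialArcs s 1ₘ t + specialArcs t (⊖ 1ₘ) s + χ (¬? (s ≟ 1F))
      ≡⟨ specialArcs-1ₘ s t ⟩
    1 ∎
    where open ≡-Reasoning
  odd-difference s d t (suc h) d≡odd =
    trans (arcs-pair s d t (⊖ d))
          (cong₂ _+_ (cong₂ _+_ (specialArcs-far s d t d≢𝟘 d≢1ₘ d≢⊖1ₘ)
                                (specialArcs-far t (⊖ d) s ⊖d≢𝟘 ⊖d≢1ₘ ⊖d≢⊖1ₘ))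
                     (cong₂ _+_ (fanArcs-odd s d (suc h) d≡odd λ ())
                                (fanArcs-even t (⊖ d) (K ∸ suc h) ⊖d≡even)))
    where
    ⊖d≡even : toℕ (⊖ d) ≡ 2 * (K ∸ suc h)
    ⊖d≡even = toℕ-⊖-odd d (suc h) d≡odd
    d≢𝟘 : d ≢ 𝟘
    d≢𝟘 d≡𝟘 with () ← trans (sym d≡odd) (cong toℕ d≡𝟘)
    d≢1ₘ : d ≢ 1ₘ
    d≢1ₘ d≡1 with () ← trans (sym d≡odd) (cong toℕ d≡1)
    d≢⊖1ₘ : d ≢ ⊖ 1ₘ
    d≢⊖1ₘ d≡-1 = even≢odd K (suc h) (trans (sym (toℕ-⊖-odd 1ₘ 0 refl)) (trans (cong toℕ (sym d≡-1)) d≡odd))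
    ⊖d≢𝟘 : ⊖ d ≢ 𝟘
    ⊖d≢𝟘 eq = m>n⇒m∸n≢0 (half-bound {d} {suc h} d≡odd)
      (*-cancelˡ-≡ (K ∸ suc h) 0 2 (trans (sym ⊖d≡even) (cong toℕ eq)))
    ⊖d≢1ₘ : ⊖ d ≢ 1ₘ
    ⊖d≢1ₘ eq = even≢odd (K ∸ suc h) 0 (trans (sym ⊖d≡even) (cong toℕ eq))
    ⊖d≢⊖1ₘ : ⊖ d ≢ ⊖ 1ₘ
    ⊖d≢⊖1ₘ = d≢1ₘ ∘ ⁻¹-injective

  isDifferenceFamily : IsDifferenceFamily baseStar bases
  isDifferenceFamily s d t x≢y with d ≟ 𝟘
  ... | yes refl = subst (λ e → baseArcs s (vertex 𝟘 t) + baseArcs t (vertex e s) ≡ 1) (sym ε⁻¹≈ε)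
        (trans (arcs-pair s 𝟘 t 𝟘) (cong₂ _+_ (specialArcs-𝟘 s t (x≢y ∘ cong (vertex 𝟘)))
                                              (cong₂ _+_ (fanArcs-even s 𝟘 0 refl) (fanArcs-even t 𝟘 0 refl))))
  ... | no d≢𝟘 with even-or-odd (toℕ d)
  ...   | inj₂ (h , d≡odd)  = odd-difference s d t h d≡odd
  ...   | inj₁ (h , d≡even) = trans (+-comm (baseArcs s (vertex d t)) (baseArcs t (vertex (⊖ d) s)))
    (subst (λ e → baseArcs t (vertex (⊖ d) s) + baseArcs s (vertex e t) ≡ 1) (⁻¹-involutive d)
           (odd-difference t (⊖ d) s (K ∸ h) (toℕ-⊖-even d h d≢𝟘 d≡even)))

  -- Fans in their colour classes

  -- The fan (s , 2j + e) belongs to the class g = parityClass s e. It is placed with its centre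
  -- in cell hub ≤ q and its leaves in cell rim = q + 1 + 3j + rimOffset g s; on a class, rim is
  -- injective, and so is hub on each slot.
  parityClass : Fin 3 → Fin 2 → Fin 2
  parityClass 0F      e = e
  parityClass (suc _) e = opposite e

  parityClass-injective : ∀ s {e e′} → parityClass s e ≡ parityClass s e′ → e ≡ e′
  parityClass-injective 0F      eq = eq
  parityClass-injective (suc _) {e} {e′} eq =
    trans (sym (opposite-involutive e)) (trans (cong opposite eq) (opposite-involutive e′))

  rimOffset : Fin 2 → Fin 3 → Fin 3
  rimOffset 0F s = s
  rimOffset 1F s = opposite s

  rimOffset-injective : ∀ g {s s′} → rimOffset g s ≡ rimOffset g s′ → s ≡ s′
  rimOffset-injective 0F eq = eq
  rimOffset-injective 1F {s} {s′} eq =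
    trans (sym (opposite-involutive s)) (trans (cong opposite eq) (opposite-involutive s′))

  halfOf : Fin K → ℕ
  halfOf i = DivMod.quotient (toℕ i divMod 2)

  bitOf : Fin K → Fin 2
  bitOf i = DivMod.remainder (toℕ i divMod 2)

  toℕ-halves : ∀ i → toℕ i ≡ toℕ (bitOf i) + halfOf i * 2
  toℕ-halves i = DivMod.property (toℕ i divMod 2)

  toℕ≤q*2 : ∀ (i : Fin K) → toℕ i ≤ q * 2
  toℕ≤q*2 i = subst (toℕ i ≤_) (*-comm 2 q) (s≤s⁻¹ (toℕ<n i))

  half+bit≤q : ∀ i → halfOf i + toℕ (bitOf i) ≤ q
  half+bit≤q i with bitOf i | toℕ-halves i
  ... | 0F | i≡2j = subst (_≤ q) (sym (+-identityʳ (halfOf i)))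
                          (*-cancelʳ-≤ (halfOf i) q 2 (subst (_≤ q * 2) i≡2j (toℕ≤q*2 i)))
  ... | 1F | i≡2j+1 = subst (_≤ q) (+-comm 1 (halfOf i))
                            (*-cancelʳ-< 2 (halfOf i) q (subst (_≤ q * 2) i≡2j+1 (toℕ≤q*2 i)))

  fanClass : Fin 3 → Fin K → Fin 2
  fanClass s i = parityClass s (bitOf i)

  rim hub : Fin 3 → Fin K → ℕ
  rim s i = suc q + (3 * halfOf i + toℕ (rimOffset (fanClass s i) s))
  hub s i = rim s i ∸ (1 + 2 * toℕ i)

  bit≤offset : ∀ s e → toℕ e ≤ toℕ (rimOffset (parityClass s e) s)
  bit≤offset 0F 0F = z≤n
  bit≤offset 0F 1F = s≤s z≤n
  bit≤offset 1F 0F = z≤n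
  bit≤offset 1F 1F = s≤s z≤n
  bit≤offset 2F 0F = z≤n
  bit≤offset 2F 1F = s≤s z≤n

  offset≤3bit+1 : ∀ s e → toℕ (rimOffset (parityClass s e) s) ≤ 3 * toℕ e + 1
  offset≤3bit+1 0F 0F = z≤n
  offset≤3bit+1 0F 1F = s≤s (s≤s z≤n)
  offset≤3bit+1 1F 0F = s≤s z≤n
  offset≤3bit+1 1F 1F = s≤s z≤n
  offset≤3bit+1 2F 0F = z≤n
  offset≤3bit+1 2F 1F = s≤s (s≤s z≤n)

  offset≤half+2bit : ∀ s e j → (s ≡ 1F → e ≡ 0F → 0 < j) → toℕ (rimOffset (parityClass s e) s) ≤ j + 2 * toℕ e
  offset≤half+2bit 0F 0F j _ = z≤n
  offset≤half+2bit 0F 1F j _ = m≤n+m 2 j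
  offset≤half+2bit 1F 0F j 0<j = subst (1 ≤_) (sym (+-identityʳ j)) (0<j refl refl)
  offset≤half+2bit 1F 1F j _ = ≤-trans (s≤s z≤n) (m≤n+m 2 j)
  offset≤half+2bit 2F 0F j _ = z≤n
  offset≤half+2bit 2F 1F j _ = m≤n+m 2 j

  δ≤rim : ∀ s i → 1 + 2 * toℕ i ≤ rim s i
  δ≤rim s i = s≤s (begin
    2 * toℕ i                      ≡⟨ cong (2 *_) (toℕ-halves i) ⟩
    2 * (e + j * 2)                ≡⟨ ring j e ⟩
    (j + e) + (3 * j + e)          ≤⟨ +-mono-≤ (half+bit≤q i) (+-monoʳ-≤ (3 * j) (bit≤offset s (bitOf i))) ⟩
    q + (3 * j + toℕ (rimOffset (fanClass s i) s)) ∎)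
    where
    open ≤-Reasoning
    j = halfOf i
    e = toℕ (bitOf i)
    ring : ∀ a b → 2 * (b + a * 2) ≡ (a + b) + (3 * a + b)
    ring = solve-∀

  rim<m : ∀ s i → rim s i < m
  rim<m s i = s≤s (begin
    suc (q + (3 * j + toℕ (rimOffset (fanClass s i) s)))
      ≤⟨ s≤s (+-monoʳ-≤ q (+-monoʳ-≤ (3 * j) (offset≤3bit+1 s (bitOf i)))) ⟩
    suc (q + (3 * j + (3 * e + 1)))   ≡⟨ ring q j e ⟩
    suc (q + (3 * (j + e) + 1))       ≤⟨ s≤s (+-monoʳ-≤ q (+-monoˡ-≤ 1 (*-monoʳ-≤ 3 (half+bit≤q i)))) ⟩
    suc (q + (3 * q + 1))             ≡⟨ ring′ q ⟩
    2 + q * 4                         ∎)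
    where
    open ≤-Reasoning
    j = halfOf i
    e = toℕ (bitOf i)
    ring : ∀ a b c → 1 + (a + (3 * b + (3 * c + 1))) ≡ 1 + (a + (3 * (b + c) + 1))
    ring = solve-∀
    ring′ : ∀ a → 1 + (a + (3 * a + 1)) ≡ 2 + a * 4
    ring′ = solve-∀

  hub<m : ∀ s i → hub s i < m
  hub<m s i = ≤-<-trans (m∸n≤m (rim s i) (1 + 2 * toℕ i)) (rim<m s i)

  hub+δ≡rim : ∀ s i → hub s i + (1 + 2 * toℕ i) ≡ rim s i
  hub+δ≡rim s i = m∸n+n≡m (δ≤rim s i)

  hub≤q : ∀ s i → (s , i) ≢ (1F , zero) → hub s i ≤ q
  hub≤q s i kept = m≤n+o⇒m∸n≤o (rim s i) (1 + 2 * toℕ i) (s≤s (begin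
    q + (3 * j + toℕ (rimOffset (fanClass s i) s))
      ≤⟨ +-monoʳ-≤ q (+-monoʳ-≤ (3 * j) (offset≤half+2bit s (bitOf i) j 0<j)) ⟩
    q + (3 * j + (j + 2 * e))   ≡⟨ ring q j e ⟩
    2 * (e + j * 2) + q         ≡⟨ cong (λ z → 2 * z + q) (toℕ-halves i) ⟨
    2 * toℕ i + q               ∎))
    where
    open ≤-Reasoning
    j = halfOf i
    e = toℕ (bitOf i)
    ring : ∀ a b c → a + (3 * b + (b + 2 * c)) ≡ 2 * (c + b * 2) + a
    ring = solve-∀
    0<j : s ≡ 1F → bitOf i ≡ 0F → 0 < j
    0<j refl e≡0 = n≢0⇒n>0 λ j≡0 → kept (cong (1F ,_) (toℕ-injective (begin-equality
      toℕ i                      ≡⟨ toℕ-halves i ⟩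
      toℕ (bitOf i) + j * 2      ≡⟨ cong₂ (λ a b → toℕ a + b * 2) e≡0 j≡0 ⟩
      0                          ∎)))

  rim-injective : ∀ {s i s′ i′} → fanClass s i ≡ fanClass s′ i′ → rim s i ≡ rim s′ i′ → (s , i) ≡ (s′ , i′)
  rim-injective {s} {i} {s′} {i′} same-class same-rim = cong₂ _,_ s≡s′ i≡i′
    where
    halves = *+-injective (halfOf i) (halfOf i′) (rimOffset (fanClass s i) s) (rimOffset (fanClass s′ i′) s′)
                          (+-cancelˡ-≡ (suc q) _ _ same-rim)
    s≡s′ : s ≡ s′
    s≡s′ = rimOffset-injective (fanClass s′ i′)
             (subst (λ g → rimOffset g s ≡ rimOffset (fanClass s′ i′) s′) same-class (proj₂ halves))
    bits : bitOf i ≡ bitOf i′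
    bits = parityClass-injective s (trans same-class (cong (λ s → parityClass s (bitOf i′)) (sym s≡s′)))
    i≡i′ : i ≡ i′
    i≡i′ = toℕ-injective (trans (toℕ-halves i)
             (trans (cong₂ (λ e j → toℕ e + j * 2) bits (proj₁ halves)) (sym (toℕ-halves i′))))

  hub-balance : ∀ s i → hub s i + (1 + 2 * toℕ (bitOf i)) + halfOf i ≡ suc q + toℕ (rimOffset (fanClass s i) s)
  hub-balance s i = +-cancelʳ-≡ (3 * halfOf i) _ _ (begin
    hub s i + (1 + 2 * e) + j + 3 * j   ≡⟨ ring (hub s i) e j ⟩
    hub s i + (1 + 2 * (e + j * 2))     ≡⟨ cong (λ z → hub s i + (1 + 2 * z)) (toℕ-halves i) ⟨
    hub s i + (1 + 2 * toℕ i)           ≡⟨ hub+δ≡rim s i ⟩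
    suc q + (3 * j + κ)                 ≡⟨ cong suc (ring′ q j κ) ⟩
    suc q + κ + 3 * j                   ∎)
    where
    open ≡-Reasoning
    j = halfOf i
    e = toℕ (bitOf i)
    κ = toℕ (rimOffset (fanClass s i) s)
    ring : ∀ a b c → a + (1 + 2 * b) + c + 3 * c ≡ a + (1 + 2 * (b + c * 2))
    ring = solve-∀
    ring′ : ∀ a b c → a + (3 * b + c) ≡ a + c + 3 * b
    ring′ = solve-∀

  hub-injective : ∀ {s i s′ i′} → s ≡ s′ → fanClass s i ≡ fanClass s′ i′ → hub s i ≡ hub s′ i′ →
    (s , i) ≡ (s′ , i′)
  hub-injective {s} {i} {_} {i′} refl same-class same-hub = cong (s ,_) (toℕ-injective (trans (toℕ-halves i)
    (trans (cong₂ (λ e j → toℕ e + j * 2) bits halves) (sym (toℕ-halves i′)))))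
    where
    bits : bitOf i ≡ bitOf i′
    bits = parityClass-injective s same-class
    halves : halfOf i ≡ halfOf i′
    halves = +-cancelˡ-≡ (hub s i′ + (1 + 2 * toℕ (bitOf i′))) _ _ (begin
      hub s i′ + (1 + 2 * toℕ (bitOf i′)) + halfOf i
        ≡⟨ cong₂ (λ h e → h + (1 + 2 * toℕ e) + halfOf i) same-hub bits ⟨
      hub s i + (1 + 2 * toℕ (bitOf i)) + halfOf i
        ≡⟨ hub-balance s i ⟩
      suc q + toℕ (rimOffset (fanClass s i) s)
        ≡⟨ cong (λ g → suc q + toℕ (rimOffset g s)) same-class ⟩
      suc q + toℕ (rimOffset (fanClass s i′) s)
        ≡⟨ hub-balance s i′ ⟨
      hub s i′ + (1 + 2 * toℕ (bitOf i′)) + halfOf i′ ∎)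
      where open ≡-Reasoning

  hubCell : Fin 3 → Fin K → Fin m
  hubCell s i = fromℕ< (hub<m s i)

  placedFan : Fin 3 → Fin K → Star (m * 3)
  placedFan s i = translateStar (hubCell s i) (baseStar (fan s i))

  hub≢rim : ∀ {s i s′ i′ v} → (s , i) ≢ (1F , zero) → v ≡ vertex (hubCell s i) s → toℕ (cell v) ≢ rim s′ i′
  hub≢rim {s} {i} {s′} {i′} kept refl v∈rim = <⇒≱ (s≤s (m≤m+n q _)) (begin
    rim s′ i′                              ≡⟨ v∈rim ⟨
    toℕ (cell (vertex (hubCell s i) s))    ≡⟨ cong toℕ (cell-vertex (hubCell s i) s) ⟩
    toℕ (hubCell s i)                      ≡⟨ toℕ-fromℕ< (hub<m s i) ⟩
    hub s i                                ≤⟨ hub≤q s i kept ⟩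
    q                                      ∎)
    where open ≤-Reasoning

  leaf-rim : ∀ s i → toℕ (hubCell s i ⊕ oddCell i) ≡ rim s i
  leaf-rim s i = trans (toℕ-⊕ h δ (subst (_< m) (sym sum) (rim<m s i))) sum
    where
    h = hubCell s i
    δ = oddCell i
    sum : toℕ h + toℕ δ ≡ rim s i
    sum = trans (cong₂ _+_ (toℕ-fromℕ< (hub<m s i)) (toℕ-oddCell i)) (hub+δ≡rim s i)

  fanStar-∈V : ∀ s i {w} → w ∈V baseStar (fan s i) → w ≡ vertex 𝟘 s ⊎ cell w ≡ oddCell i
  fanStar-∈V s i (inj₁ w≡hub)              = inj₁ w≡hub
  fanStar-∈V s i (inj₂ (inj₁ w≡leaf))      = inj₂ (trans (cong cell w≡leaf) (cell-vertex (oddCell i) 0F))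
  fanStar-∈V s i (inj₂ (inj₂ (inj₁ w≡leaf))) = inj₂ (trans (cong cell w≡leaf) (cell-vertex (oddCell i) 1F))
  fanStar-∈V s i (inj₂ (inj₂ (inj₂ w≡leaf))) = inj₂ (trans (cong cell w≡leaf) (cell-vertex (oddCell i) 2F))

  placedFan-∈V : ∀ s i {v} → v ∈V placedFan s i → v ≡ vertex (hubCell s i) s ⊎ toℕ (cell v) ≡ rim s i
  placedFan-∈V s i v∈ =
    let w , w∈ , v≡ = mapStar-∈V⁻ (translate-injective (hubCell s i)) (baseStar (fan s i)) v∈
    in  translated (fanStar-∈V s i w∈) v≡
    where
    h = hubCell s i
    translated : ∀ {v w} → w ≡ vertex 𝟘 s ⊎ cell w ≡ oddCell i → v ≡ translate h w →
      v ≡ vertex h s ⊎ toℕ (cell v) ≡ rim s i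
    translated (inj₁ refl) refl = inj₁ (trans (translate-vertex h 𝟘 s) (cong (λ a → vertex a s) (⊕-identityʳ h)))
    translated {w = w} (inj₂ w∈rim) refl = inj₂ (begin
      toℕ (cell (translate h w))   ≡⟨ cong toℕ (cell-vertex (h ⊕ cell w) (slot w)) ⟩
      toℕ (h ⊕ cell w)             ≡⟨ cong (λ c → toℕ (h ⊕ c)) w∈rim ⟩
      toℕ (h ⊕ oddCell i)          ≡⟨ leaf-rim s i ⟩
      rim s i                      ∎)
      where open ≡-Reasoning

  placedFans-disjoint : ∀ {s i s′ i′} → (s , i) ≢ (1F , zero) → (s′ , i′) ≢ (1F , zero) →
    fanClass s i ≡ fanClass s′ i′ → (s , i) ≢ (s′ , i′) → VertexDisjoint (placedFan s i) (placedFan s′ i′)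
  placedFans-disjoint {s} {i} {s′} {i′} kept kept′ same-class distinct v (v∈ , v∈′) =
    apart (placedFan-∈V s i v∈) (placedFan-∈V s′ i′ v∈′)
    where
    apart : v ≡ vertex (hubCell s i) s ⊎ toℕ (cell v) ≡ rim s i →
            v ≡ vertex (hubCell s′ i′) s′ ⊎ toℕ (cell v) ≡ rim s′ i′ → ⊥
    apart (inj₁ v≡hub) (inj₁ v≡hub′) =
      let same-cell , same-slot = vertex-injective (trans (sym v≡hub) v≡hub′)
      in  distinct (hub-injective same-slot same-class
            (trans (sym (toℕ-fromℕ< (hub<m s i))) (trans (cong toℕ same-cell) (toℕ-fromℕ< (hub<m s′ i′)))))
    apart (inj₁ v≡hub) (inj₂ v∈rim′) = hub≢rim {s′ = s′} {i′} kept v≡hub v∈rim′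
    apart (inj₂ v∈rim) (inj₁ v≡hub′) = hub≢rim {s′ = s} {i} kept′ v≡hub′ v∈rim
    apart (inj₂ v∈rim) (inj₂ v∈rim′) =
      distinct (rim-injective {s} {i} {s′} {i′} same-class (trans (sym v∈rim) v∈rim′))

  -- Special stars in their colour classes

  starA-cells : ∀ a {v} → v ∈V translateStar a (baseStar starA) → cell v ≡ a ⊕ ⊖ 1ₘ ⊎ cell v ≡ a ⊕ 𝟘
  starA-cells a v∈ = let w , w∈ , v∈a = translateStar-cell a (baseStar starA) v∈ in at-offset w∈ v∈a
    where
    shift : ∀ {v w} c σ → cell v ≡ a ⊕ cell w → w ≡ vertex c σ → cell v ≡ a ⊕ c
    shift c σ v∈a refl = trans v∈a (cong (a ⊕_) (cell-vertex c σ))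
    at-offset : ∀ {v w} → w ∈V baseStar starA → cell v ≡ a ⊕ cell w → cell v ≡ a ⊕ ⊖ 1ₘ ⊎ cell v ≡ a ⊕ 𝟘
    at-offset (inj₁ w≡)                v∈a = inj₂ (shift 𝟘 0F v∈a w≡)
    at-offset (inj₂ (inj₁ w≡))         v∈a = inj₂ (shift 𝟘 1F v∈a w≡)
    at-offset (inj₂ (inj₂ (inj₁ w≡)))  v∈a = inj₂ (shift 𝟘 2F v∈a w≡)
    at-offset (inj₂ (inj₂ (inj₂ w≡)))  v∈a = inj₁ (shift (⊖ 1ₘ) 1F v∈a w≡)

  starB-cells : ∀ a {v} → v ∈V translateStar a (baseStar starB) → cell v ≡ a ⊕ 𝟘 ⊎ cell v ≡ a ⊕ 1ₘ
  starB-cells a v∈ = let w , w∈ , v∈a = translateStar-cell a (baseStar starB) v∈ in at-offset w∈ v∈a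
    where
    shift : ∀ {v w} c σ → cell v ≡ a ⊕ cell w → w ≡ vertex c σ → cell v ≡ a ⊕ c
    shift c σ v∈a refl = trans v∈a (cong (a ⊕_) (cell-vertex c σ))
    at-offset : ∀ {v w} → w ∈V baseStar starB → cell v ≡ a ⊕ cell w → cell v ≡ a ⊕ 𝟘 ⊎ cell v ≡ a ⊕ 1ₘ
    at-offset (inj₁ w≡)                v∈a = inj₁ (shift 𝟘 1F v∈a w≡)
    at-offset (inj₂ (inj₁ w≡))         v∈a = inj₁ (shift 𝟘 2F v∈a w≡)
    at-offset (inj₂ (inj₂ (inj₁ w≡)))  v∈a = inj₂ (shift 1ₘ 1F v∈a w≡)
    at-offset (inj₂ (inj₂ (inj₂ w≡)))  v∈a = inj₂ (shift 1ₘ 2F v∈a w≡)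

  -- starA at cell 0 and starB at cell 1 would need the colour value ⊖ 1ₘ, which is not available;
  -- they join the classes of values 2ₘ and 3ₘ instead, as the kinds A₋₂ and B₋₂.
  data Special : Set where
    A₁ A₋₂ B₂ B₋₂ : Special

  specialBase : Special → Base
  specialBase A₁  = starA
  specialBase A₋₂ = starA
  specialBase B₂  = starB
  specialBase B₋₂ = starB

  specialAnchor : Special → Fin m
  specialAnchor A₁  = 1ₘ
  specialAnchor A₋₂ = ⊖ 2ₘ
  specialAnchor B₂  = 2ₘ
  specialAnchor B₋₂ = ⊖ 2ₘ

  specialLow : Special → ℕ
  specialLow A₁  = 0
  specialLow B₂  = 2
  specialLow A₋₂ = m ∸ 3
  specialLow B₋₂ = m ∸ 2

  placedSpecial : Special → Star (m * 3)
  placedSpecial k = translateStar (specialAnchor k) (baseStar (specialBase k))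

  occupies-cells : ∀ {N c} (lo hi : Fin m) → toℕ lo ≡ c → toℕ hi ≡ suc c →
    (∀ {v} → v ∈V N → cell v ≡ lo ⊎ cell v ≡ hi) → Occupies N c
  occupies-cells {c = c} lo hi lo≡c hi≡1+c cells v∈ with cells v∈
  ... | inj₁ v∈lo = let v≡c = trans (cong toℕ v∈lo) lo≡c in
    ≤-reflexive (sym v≡c) , ≤-trans (≤-reflexive v≡c) (n≤1+n c)
  ... | inj₂ v∈hi = let v≡1+c = trans (cong toℕ v∈hi) hi≡1+c in
    ≤-trans (n≤1+n c) (≤-reflexive (sym v≡1+c)) , ≤-reflexive v≡1+c

  placedSpecial-occupies : ∀ k → Occupies (placedSpecial k) (specialLow k)
  placedSpecial-occupies A₁ =
    occupies-cells {placedSpecial A₁} (1ₘ ⊕ ⊖ 1ₘ) (1ₘ ⊕ 𝟘)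
      (cong toℕ (⊖-inverseʳ 1ₘ)) (cong toℕ (⊕-identityʳ 1ₘ)) (starA-cells 1ₘ)
  placedSpecial-occupies A₋₂ =
    occupies-cells {placedSpecial A₋₂} (⊖ 2ₘ ⊕ ⊖ 1ₘ) (⊖ 2ₘ ⊕ 𝟘)
      (trans (cong toℕ (⁻¹-∙-comm 2ₘ 1ₘ)) (toℕ-⊖ 3ₘ λ ()))
      (trans (cong toℕ (⊕-identityʳ (⊖ 2ₘ))) (toℕ-⊖ 2ₘ λ ()))
      (starA-cells (⊖ 2ₘ))
  placedSpecial-occupies B₂ = occupies-cells {placedSpecial B₂} (2ₘ ⊕ 𝟘) (2ₘ ⊕ 1ₘ) refl refl (starB-cells 2ₘ)
  placedSpecial-occupies B₋₂ =
    occupies-cells {placedSpecial B₋₂} (⊖ 2ₘ ⊕ 𝟘) (⊖ 2ₘ ⊕ 1ₘ)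
      (trans (cong toℕ (⊕-identityʳ (⊖ 2ₘ))) (toℕ-⊖ 2ₘ λ ()))
      (trans (toℕ-⊕ (⊖ 2ₘ) 1ₘ (subst (_< m) (sym (trans (cong (_+ 1) ⊖2≡) (+-comm (m ∸ 2) 1))) ≤-refl))
             (trans (cong (_+ 1) ⊖2≡) (+-comm (m ∸ 2) 1)))
      (starB-cells (⊖ 2ₘ))
    where
    ⊖2≡ : toℕ (⊖ 2ₘ) ≡ m ∸ 2
    ⊖2≡ = toℕ-⊖ 2ₘ λ ()

  low-gap : ∀ k k′ → k ≢ k′ → (k , k′) ≢ (A₋₂ , B₋₂) → (k , k′) ≢ (B₋₂ , A₋₂) →
    2 + specialLow k ≤ specialLow k′ ⊎ 2 + specialLow k′ ≤ specialLow k
  low-gap A₁  A₁  k≢k′ _ _ = contradiction refl k≢k′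
  low-gap A₁  A₋₂ _ _ _    = inj₁ (s≤s (s≤s z≤n))
  low-gap A₁  B₂  _ _ _    = inj₁ ≤-refl
  low-gap A₁  B₋₂ _ _ _    = inj₁ (s≤s (s≤s z≤n))
  low-gap A₋₂ A₁  _ _ _    = inj₂ (s≤s (s≤s z≤n))
  low-gap A₋₂ A₋₂ k≢k′ _ _ = contradiction refl k≢k′
  low-gap A₋₂ B₂  _ _ _    = inj₂ (s≤s (s≤s (s≤s (s≤s z≤n))))
  low-gap A₋₂ B₋₂ _ ≢ab _  = contradiction refl ≢ab
  low-gap B₂  A₁  _ _ _    = inj₂ ≤-refl
  low-gap B₂  A₋₂ _ _ _    = inj₁ (s≤s (s≤s (s≤s (s≤s z≤n))))
  low-gap B₂  B₂  k≢k′ _ _ = contradiction refl k≢k′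
  low-gap B₂  B₋₂ _ _ _    = inj₁ (s≤s (s≤s (s≤s (s≤s z≤n))))
  low-gap B₋₂ A₁  _ _ _    = inj₂ (s≤s (s≤s z≤n))
  low-gap B₋₂ A₋₂ _ _ ≢ba  = contradiction refl ≢ba
  low-gap B₋₂ B₂  _ _ _    = inj₂ (s≤s (s≤s (s≤s (s≤s z≤n))))
  low-gap B₋₂ B₋₂ k≢k′ _ _ = contradiction refl k≢k′

  placedSpecials-gap : ∀ k k′ → 2 + specialLow k ≤ specialLow k′ → VertexDisjoint (placedSpecial k) (placedSpecial k′)
  placedSpecials-gap k k′ =
    occupies-apart {placedSpecial k} {placedSpecial k′} (placedSpecial-occupies k) (placedSpecial-occupies k′)

  placedSpecials-disjoint : ∀ k k′ → k ≢ k′ → (k , k′) ≢ (A₋₂ , B₋₂) → (k , k′) ≢ (B₋₂ , A₋₂) →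
    VertexDisjoint (placedSpecial k) (placedSpecial k′)
  placedSpecials-disjoint k k′ k≢k′ ≢ab ≢ba with low-gap k k′ k≢k′ ≢ab ≢ba
  ... | inj₁ gap = placedSpecials-gap k k′ gap
  ... | inj₂ gap = vertexDisjoint-sym {s = placedSpecial k′} {placedSpecial k} (placedSpecials-gap k′ k gap)

  data IsSpecial : Base → Set where
    isA : IsSpecial starA
    isB : IsSpecial starB

  specialKind : ∀ {τ} → IsSpecial τ → Fin m → Special
  specialKind isA zero          = A₋₂
  specialKind isA (suc _)       = A₁
  specialKind isB (suc zero)    = B₋₂
  specialKind isB zero          = B₂
  specialKind isB (suc (suc _)) = B₂

  Label : Set
  Label = Base × Fin m

  labels : List Label
  labels = cartesianProduct bases (allFin m)

  label∈ : ∀ {τ} b → τ ∈ bases → (τ , b) ∈ labels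
  label∈ b τ∈ = ∈-cartesianProduct⁺ τ∈ (∈-allFin b)

  labelStar : Label → Star (m * 3)
  labelStar (τ , b) = translateStar b (baseStar τ)

  anchor : Label → Fin m
  anchor (fan s i , _) = hubCell s i
  anchor (starA , b)   = specialAnchor (specialKind isA b)
  anchor (starB , b)   = specialAnchor (specialKind isB b)

  colourClass : Base → Fin 3
  colourClass (fan s i) = inject₁ (fanClass s i)
  colourClass starA     = 2F
  colourClass starB     = 2F

  colourValue : Label → Fin m
  colourValue ℓ = proj₂ ℓ ⊕ ⊖ anchor ℓ

  -- A label's star is the translate by its colour value of its placed star, so the stars of one
  -- colour are translates by a common element of pairwise disjoint placed stars.
  placed : Label → Star (m * 3)
  placed (τ , b) = translateStar (anchor (τ , b)) (baseStar τ)

  value+anchor : ∀ ℓ → colourValue ℓ ⊕ anchor ℓ ≡ proj₂ ℓ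
  value+anchor ℓ = //-rightDividesˡ (anchor ℓ) (proj₂ ℓ)

  same-placement : ∀ ℓ ℓ′ → colourValue ℓ ≡ colourValue ℓ′ → anchor ℓ ≡ anchor ℓ′ → proj₂ ℓ ≡ proj₂ ℓ′
  same-placement ℓ ℓ′ same-value same-anchor =
    trans (sym (value+anchor ℓ)) (trans (cong₂ _⊕_ same-value same-anchor) (value+anchor ℓ′))

  labelStars-disjoint : ∀ ℓ ℓ′ → colourValue ℓ ≡ colourValue ℓ′ → VertexDisjoint (placed ℓ) (placed ℓ′) →
    VertexDisjoint (labelStar ℓ) (labelStar ℓ′)
  labelStars-disjoint ℓ@(τ , b) ℓ′@(τ′ , b′) same-value apart =
    subst₂ VertexDisjoint
      (cong (λ c → translateStar c (baseStar τ)) (value+anchor ℓ))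
      (cong (λ c → translateStar c (baseStar τ′)) (trans (cong (_⊕ anchor ℓ′) same-value) (value+anchor ℓ′)))
      (translateStar-disjoint (colourValue ℓ) {anchor ℓ} {anchor ℓ′} {baseStar τ} {baseStar τ′} apart)

  placed-special : ∀ {τ} (sp : IsSpecial τ) b → placed (τ , b) ≡ placedSpecial (specialKind sp b)
  placed-special isA zero          = refl
  placed-special isA (suc _)       = refl
  placed-special isB (suc zero)    = refl
  placed-special isB zero          = refl
  placed-special isB (suc (suc _)) = refl

  base-specialKind : ∀ {τ} (sp : IsSpecial τ) b → specialBase (specialKind sp b) ≡ τ
  base-specialKind isA zero          = refl
  base-specialKind isA (suc _)       = refl
  base-specialKind isB (suc zero)    = refl
  base-specialKind isB zero          = refl
  base-specialKind isB (suc (suc _)) = refl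

  anchor-specialKind : ∀ {τ} (sp : IsSpecial τ) b → anchor (τ , b) ≡ specialAnchor (specialKind sp b)
  anchor-specialKind isA b = refl
  anchor-specialKind isB b = refl

  value-A₋₂ : ∀ {τ} (sp : IsSpecial τ) b → specialKind sp b ≡ A₋₂ → colourValue (τ , b) ≡ 2ₘ
  value-A₋₂ isA zero refl = trans (⊕-identityˡ (⊖ ⊖ 2ₘ)) (⁻¹-involutive 2ₘ)
  value-A₋₂ isA (suc _) ()
  value-A₋₂ isB (suc zero) ()
  value-A₋₂ isB zero ()
  value-A₋₂ isB (suc (suc _)) ()

  value-B₋₂ : ∀ {τ} (sp : IsSpecial τ) b → specialKind sp b ≡ B₋₂ → colourValue (τ , b) ≡ 3ₘ
  value-B₋₂ isB (suc zero) refl = cong (1ₘ ⊕_) (⁻¹-involutive 2ₘ)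
  value-B₋₂ isA zero ()
  value-B₋₂ isA (suc _) ()
  value-B₋₂ isB zero ()
  value-B₋₂ isB (suc (suc _)) ()

  placedSpecials-apart : ∀ {τ b τ′ b′} (sp : IsSpecial τ) (sp′ : IsSpecial τ′) → (τ , b) ≢ (τ′ , b′) →
    colourValue (τ , b) ≡ colourValue (τ′ , b′) → VertexDisjoint (placed (τ , b)) (placed (τ′ , b′))
  placedSpecials-apart {τ} {b} {τ′} {b′} sp sp′ ℓ≢ℓ′ same-value =
    subst₂ VertexDisjoint (sym (placed-special sp b)) (sym (placed-special sp′ b′))
      (placedSpecials-disjoint (specialKind sp b) (specialKind sp′ b′) k≢k′ ≢ab ≢ba)
    where
    k≢k′ : specialKind sp b ≢ specialKind sp′ b′
    k≢k′ same-kind = ℓ≢ℓ′ (cong₂ _,_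
      (trans (sym (base-specialKind sp b)) (trans (cong specialBase same-kind) (base-specialKind sp′ b′)))
      (same-placement (τ , b) (τ′ , b′) same-value
        (trans (anchor-specialKind sp b) (trans (cong specialAnchor same-kind) (sym (anchor-specialKind sp′ b′))))))
    ≢ab : (specialKind sp b , specialKind sp′ b′) ≢ (A₋₂ , B₋₂)
    ≢ab eq = let a , b = ,-injective eq in
      2ₘ≢3ₘ (trans (sym (value-A₋₂ sp _ a)) (trans same-value (value-B₋₂ sp′ _ b)))
    ≢ba : (specialKind sp b , specialKind sp′ b′) ≢ (B₋₂ , A₋₂)
    ≢ba eq = let b , a = ,-injective eq in
      2ₘ≢3ₘ (sym (trans (sym (value-B₋₂ sp _ b)) (trans same-value (value-A₋₂ sp′ _ a))))

  fan-label-kept : ∀ {s i b} → (fan s i , b) ∈ labels → (s , i) ≢ (1F , zero)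
  fan-label-kept ℓ∈ = fan∈bases⇒kept (proj₁ (∈-cartesianProduct⁻ bases (allFin m) ℓ∈))

  placedFan-labels-apart : ∀ {s i b s′ i′ b′} → (fan s i , b) ∈ labels → (fan s′ i′ , b′) ∈ labels →
    (fan s i , b) ≢ (fan s′ i′ , b′) → colourValue (fan s i , b) ≡ colourValue (fan s′ i′ , b′) →
    fanClass s i ≡ fanClass s′ i′ → VertexDisjoint (placedFan s i) (placedFan s′ i′)
  placedFan-labels-apart {s} {i} {b} {s′} {i′} {b′} ℓ∈ ℓ′∈ ℓ≢ℓ′ same-value same-class =
    placedFans-disjoint (fan-label-kept ℓ∈) (fan-label-kept ℓ′∈) same-class λ same-fan →
      ℓ≢ℓ′ (cong₂ _,_ (cong (uncurry fan) same-fan)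
                      (same-placement (fan s i , b) (fan s′ i′ , b′) same-value (cong (uncurry hubCell) same-fan)))

  inject₁≢2F : ∀ (g : Fin 2) → inject₁ g ≢ 2F
  inject₁≢2F 0F ()
  inject₁≢2F 1F ()

  fan≢special : ∀ s i → colourClass (fan s i) ≢ 2F
  fan≢special s i = inject₁≢2F (fanClass s i)

  placed-apart : ∀ {ℓ ℓ′} → ℓ ∈ labels → ℓ′ ∈ labels → ℓ ≢ ℓ′ → colourValue ℓ ≡ colourValue ℓ′ →
    colourClass (proj₁ ℓ) ≡ colourClass (proj₁ ℓ′) → VertexDisjoint (placed ℓ) (placed ℓ′)
  placed-apart {fan s i , _} {fan s′ i′ , _} ℓ∈ ℓ′∈ ℓ≢ℓ′ same-value same-class =
    placedFan-labels-apart ℓ∈ ℓ′∈ ℓ≢ℓ′ same-value (inject₁-injective same-class)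
  placed-apart {fan s i , _} {starA , _} _ _ _ _ same-class = contradiction same-class (fan≢special s i)
  placed-apart {fan s i , _} {starB , _} _ _ _ _ same-class = contradiction same-class (fan≢special s i)
  placed-apart {starA , _} {fan s i , _} _ _ _ _ same-class = contradiction (sym same-class) (fan≢special s i)
  placed-apart {starB , _} {fan s i , _} _ _ _ _ same-class = contradiction (sym same-class) (fan≢special s i)
  placed-apart {starA , _} {starA , _} _ _ ℓ≢ℓ′ same-value _ = placedSpecials-apart isA isA ℓ≢ℓ′ same-value
  placed-apart {starA , _} {starB , _} _ _ ℓ≢ℓ′ same-value _ = placedSpecials-apart isA isB ℓ≢ℓ′ same-value
  placed-apart {starB , _} {starA , _} _ _ ℓ≢ℓ′ same-value _ = placedSpecials-apart isB isA ℓ≢ℓ′ same-value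
  placed-apart {starB , _} {starB , _} _ _ ℓ≢ℓ′ same-value _ = placedSpecials-apart isB isB ℓ≢ℓ′ same-value

  last≡ : m * 3 ∸ 1 ≡ 3 * toℕ (⊖ 1ₘ) + 2
  last≡ = trans (ring q′) (cong (λ z → 3 * z + 2) (sym toℕ-⊖1ₘ))
    where
    ring : ∀ a → 2 + (2 + suc a * 4) * 3 ≡ 3 * (2 + suc a * 4) + 2
    ring = solve-∀

  isLast : ∀ (v : Fin m) (g : Fin 3) → toℕ (combine v g) ≡ m * 3 ∸ 1 → v ≡ ⊖ 1ₘ × g ≡ 2F
  isLast v g eq =
    let v≡ , g≡ = *+-injective (toℕ v) (toℕ (⊖ 1ₘ)) g 2F (trans (sym (toℕ-combine v g)) (trans eq last≡))
    in  toℕ-injective v≡ , g≡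

  special-value≢⊖1ₘ : ∀ {τ} (sp : IsSpecial τ) b → colourValue (τ , b) ≢ ⊖ 1ₘ
  special-value≢⊖1ₘ {τ} sp b value≡ =
    impossible sp b (trans (sym (value+anchor (τ , b))) (cong (_⊕ anchor (τ , b)) value≡))
    where
    ⊖3ₘ≡ : toℕ (⊖ 1ₘ ⊕ ⊖ 2ₘ) ≡ m ∸ 3
    ⊖3ₘ≡ = trans (cong toℕ (⁻¹-∙-comm 1ₘ 2ₘ)) (toℕ-⊖ 3ₘ λ ())
    impossible : ∀ {τ} (sp : IsSpecial τ) b → b ≢ ⊖ 1ₘ ⊕ anchor (τ , b)
    impossible isA zero          eq with () ← trans (cong toℕ eq) ⊖3ₘ≡
    impossible isA (suc _)       eq with () ← trans eq (⊖-inverseˡ 1ₘ)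
    impossible isB (suc zero)    eq with () ← trans (cong toℕ eq) ⊖3ₘ≡
    impossible isB zero          eq with () ← trans eq (\\-leftDividesʳ 1ₘ 1ₘ)
    impossible isB (suc (suc _)) eq with () ← trans eq (\\-leftDividesʳ 1ₘ 1ₘ)

  notLast : ∀ ℓ → m * 3 ∸ 1 ≢ toℕ (combine (colourValue ℓ) (colourClass (proj₁ ℓ)))
  notLast ℓ@(fan s i , b) eq = inject₁≢2F (fanClass s i) (proj₂ (isLast (colourValue ℓ) _ (sym eq)))
  notLast ℓ@(starA , b)   eq = special-value≢⊖1ₘ isA b (proj₁ (isLast (colourValue ℓ) _ (sym eq)))
  notLast ℓ@(starB , b)   eq = special-value≢⊖1ₘ isB b (proj₁ (isLast (colourValue ℓ) _ (sym eq)))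

  -- The colour (v , g) is combine v g, whose last value (⊖ 1ₘ , 2F) is never taken.
  colour : Label → Fin (m * 3 ∸ 1)
  colour ℓ = lower₁ (combine (colourValue ℓ) (colourClass (proj₁ ℓ))) (notLast ℓ)

  colour-components : ∀ ℓ ℓ′ → colour ℓ ≡ colour ℓ′ →
    colourValue ℓ ≡ colourValue ℓ′ × colourClass (proj₁ ℓ) ≡ colourClass (proj₁ ℓ′)
  colour-components ℓ ℓ′ eq = combine-injective _ _ _ _
    (trans (sym (inject₁-lower₁ _ (notLast ℓ))) (trans (cong inject₁ eq) (inject₁-lower₁ _ (notLast ℓ′))))

  labels-apart : ∀ {ℓ ℓ′} → ℓ ∈ labels → ℓ′ ∈ labels → ℓ ≢ ℓ′ → colour ℓ ≡ colour ℓ′ →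
    VertexDisjoint (labelStar ℓ) (labelStar ℓ′)
  labels-apart {ℓ} {ℓ′} ℓ∈ ℓ′∈ ℓ≢ℓ′ same-colour =
    let same-value , same-class = colour-components ℓ ℓ′ same-colour
    in  labelStars-disjoint ℓ ℓ′ same-value (placed-apart ℓ∈ ℓ′∈ ℓ≢ℓ′ same-value same-class)

  value-starA : ∀ v → v ≢ ⊖ 1ₘ → colourValue (starA , v ⊕ 1ₘ) ≡ v
  value-starA v v≢⊖1 = trans (generic (v ⊕ 1ₘ) λ eq → v≢⊖1 (inverseˡ-unique v 1ₘ eq)) (//-rightDividesʳ 1ₘ v)
    where
    generic : ∀ b → b ≢ 𝟘 → colourValue (starA , b) ≡ b ⊕ ⊖ 1ₘ
    generic zero    b≢𝟘 = contradiction refl b≢𝟘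
    generic (suc b) _   = refl

  labelWith : ∀ (v : Fin m) (g : Fin 3) → (v , g) ≢ (⊖ 1ₘ , 2F) →
    ∃ λ ℓ → ℓ ∈ labels × combine (colourValue ℓ) (colourClass (proj₁ ℓ)) ≡ combine v g
  labelWith v 0F _ = (fan 0F zero , v ⊕ hubCell 0F zero) , label∈ _ (fan∈bases λ ())
                   , cong (λ a → combine {m} {3} a 0F) (//-rightDividesʳ (hubCell 0F zero) v)
  labelWith v 1F _ = (fan 2F zero , v ⊕ hubCell 2F zero) , label∈ _ (fan∈bases λ ())
                   , cong (λ a → combine {m} {3} a 1F) (//-rightDividesʳ (hubCell 2F zero) v)
  labelWith v 2F not-last = (starA , v ⊕ 1ₘ) , label∈ _ (here refl)
                          , cong (λ a → combine {m} {3} a 2F) (value-starA v (not-last ∘ cong (_, 2F)))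

  colour-onto : ∀ c → ∃ λ ℓ → ℓ ∈ labels × colour ℓ ≡ c
  colour-onto c =
    let v , g , v,g↦c = combine-surjective {m} {3} (inject₁ c)
        ℓ , ℓ∈ , ℓ↦v,g = labelWith v g (not-last v g v,g↦c)
    in  ℓ , ℓ∈ , inject₁≡⇒lower₁≡ (notLast ℓ) (sym (trans ℓ↦v,g v,g↦c))
    where
    not-last : ∀ (v : Fin m) (g : Fin 3) → combine v g ≡ inject₁ c → (v , g) ≢ (⊖ 1ₘ , 2F)
    not-last v g v,g↦c refl = <-irrefl (begin-equality
      toℕ c                          ≡⟨ toℕ-inject₁ c ⟨
      toℕ (inject₁ c)                ≡⟨ cong toℕ v,g↦c ⟨
      toℕ (combine (⊖ 1ₘ) 2F)        ≡⟨ toℕ-combine (⊖ 1ₘ) 2F ⟩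
      3 * toℕ (⊖ 1ₘ) + 2             ≡⟨ last≡ ⟨
      m * 3 ∸ 1                      ∎) (toℕ<n c)
      where open ≤-Reasoning

  system : Σ (List (Star (m * 3))) (λ bs → IsStarSystem (m * 3) bs × BlockColourable bs (m * 3 ∸ 1))
  system = development baseStar bases
         , development-isStarSystem baseStar bases centred isDifferenceFamily
         , blockColourable-map labelStar (Unique.cartesianProduct⁺ unique-bases (Unique.allFin⁺ m))
                               colour colour-onto labels-apart

theorem4p3 : (n : ℕ) → n ≥ 1 → n % 12 ≡ 9 →
    Σ (List (Star n)) (λ bs → IsStarSystem n bs × BlockColourable bs (n ∸ 1))
-- The hypothesis n ≥ 1 already follows from n % 12 ≡ 9.
theorem4p3 n _ n%12≡9 = subst Solution (sym n≡9+12q) (solution (n / 12))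
  where
  Solution : ℕ → Set
  Solution n = Σ (List (Star n)) (λ bs → IsStarSystem n bs × BlockColourable bs (n ∸ 1))
  n≡9+12q : n ≡ 9 + n / 12 * 12
  n≡9+12q = trans (m≡m%n+[m/n]*n n 12) (cong (_+ n / 12 * 12) n%12≡9)
  solution : ∀ q → Solution (9 + q * 12)
  solution zero     = system9
  solution (suc q′) = subst Solution (ring q′) (Construction.system q′)
    where
    ring : ∀ a → (3 + suc a * 4) * 3 ≡ 9 + suc a * 12
    ring = solve-∀
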